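{- For every $k\ge 0$, let $f_k(x_1,\dots,x_k)=\sum_{\gamma} x_1^{p_1}\cdots x_k^{p_k}$, the sum running over all standard paths $\gamma$ whose final composition $(p_1,\dots,p_k)$ has exactly $k$ parts. Then \[ f_k(x_1,\dots,x_k)=\frac{x_1\cdots x_k}{\prod_{i=1}^k\prod_{j=i}^k(1-x_i-x_{i+1}-\cdots-x_j)}\,\tilde f_k(x_1,\dots,x_k) \] for some polynomial $\tilde f_k(x_1,\dots,x_k)$.
   Context: A composition is a finite sequence $P=(p_1,\dots,p_k)$ of positive integers (its parts); $k$ is the number of parts, the empty composition $()$ has $0$ parts, and the weight of $P$ is $p_1+\cdots+p_k$. $Q$ covers $P=(p_1,\dots,p_k)$ if $Q$ is one of $(1,p_1,\dots,p_k)$, $(p_1,\dots,p_k,1)$, or $(p_1,\dots,p_i+1,\dots,p_k)$ for some $1\le i\le k$. A standard path of length $n$ is a sequence $(P_0,P_1,\dots,P_n)$ of compositions with $P_i$ of weight $i$ and $P_{i+1}$ covering $P_i$ for each $i$; its final composition is $P_n$. Standard paths are distinct iff they differ as sequences of compositions. -}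

module Defs where

open import Data.Nat as ℕ using (ℕ; zero; suc; _∸_; _≤ᵇ_)
open import Data.Integer as ℤ using (ℤ; +_; -_)
open import Data.Bool using (Bool; true; false; if_then_else_; _∧_)
open import Data.List as L using (List; []; _∷_; _++_; [_]; map; concatMap; length; filter; deduplicate; foldr)
import Data.List.Properties as LP
import Data.List.Base as LB
open import Data.Bool.ListAction using () renaming (all to allᵇ)
open import Data.Nat.ListAction using () renaming (sum to sumℕ)
open import Data.Vec as V using (Vec; []; _∷_; toList; zipWith)
import Data.Vec.Properties as VP
open import Data.Fin using (Fin; toℕ)
open import Data.Fin.Properties using (all?)
open import Data.Product using (Σ; _×_; _,_)
open import Relation.Nullary using (does)
open import Relation.Binary.PropositionalEquality using (_≡_)

-- A composition is a list of natural numbers; only lists with all parts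
-- positive arise below (they are generated from () by covering moves).
Composition : Set
Composition = List ℕ

_≟C_ : (P Q : Composition) → Relation.Nullary.Dec (P ≡ Q)
_≟C_ = LP.≡-dec ℕ._≟_

increments : Composition → List Composition
increments []       = []
increments (p ∷ ps) = (suc p ∷ ps) ∷ map (p ∷_) (increments ps)

-- all compositions covering P (as a list, with possible repetitions)
coversRaw : Composition → List Composition
coversRaw P = (1 ∷ P) ∷ (P ++ [ 1 ]) ∷ increments P

covers : Composition → List Composition
covers P = deduplicate _≟C_ (coversRaw P)

-- A standard path is stored as the reversed list (Pₙ ∷ … ∷ P₀ ∷ []).
-- stdPaths n lists all standard paths of length n, each exactly once.
stdPaths : ℕ → List (List Composition)
stdPaths zero    = [ [] ∷ [] ]
stdPaths (suc n) = concatMap extend (stdPaths n)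
  where
  extend : List Composition → List (List Composition)
  extend []          = []
  extend (P ∷ rest)  = map (λ Q → Q ∷ P ∷ rest) (covers P)

finalComp : List Composition → Composition
finalComp []      = []
finalComp (P ∷ _) = P

weight : Composition → ℕ
weight = sumℕ

numPaths : Composition → ℕ
numPaths P = length (filter (λ γ → finalComp γ ≟C P) (stdPaths (weight P)))

Exp : ℕ → Set
Exp k = Vec ℕ k

Series : ℕ → Set
Series k = Exp k → ℤ

below : ∀ {k} → Exp k → List (Exp k)
below []       = [ [] ]
below (e ∷ es) = concatMap (λ a → map (a ∷_) (below es)) (LB.upTo (suc e))

sumℤ : List ℤ → ℤ
sumℤ = foldr ℤ._+_ (+ 0)

_⋆_ : ∀ {k} → Series k → Series k → Series k
(F ⋆ G) e = sumℤ (map (λ a → F a ℤ.* G (zipWith _∸_ e a)) (below e))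

oneS : ∀ {k} → Series k
oneS e = if allᵇ (λ n → n ℕ.≡ᵇ 0) (toList e) then + 1 else + 0

prodS : ∀ {k} → List (Series k) → Series k
prodS = foldr _⋆_ oneS

IsPolynomial : ∀ {k} → Series k → Set
IsPolynomial {k} g = Σ ℕ λ N → ∀ (e : Exp k) → N ℕ.< sumℕ (toList e) → g e ≡ + 0

f : (k : ℕ) → Series k
f k e = if allᵇ (λ n → 1 ≤ᵇ n) (toList e) then + numPaths (toList e) else + 0

xAll : (k : ℕ) → Series k
xAll k e = if allᵇ (λ n → n ℕ.≡ᵇ 1) (toList e) then + 1 else + 0

-- 1 - x_i - x_{i+1} - ⋯ - x_j  (indices i ≤ j in Fin k, 0-based)
linFactor : (k : ℕ) → Fin k → Fin k → Series k
linFactor k i j e =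
  if allᵇ (λ n → n ℕ.≡ᵇ 0) (toList e) then + 1
  else if (sumℕ (toList e) ℕ.≡ᵇ 1) ∧ inRange (toList e) 0 then - (+ 1)
  else + 0
  where
  inRange : List ℕ → ℕ → Bool
  inRange []       m = false
  inRange (n ∷ ns) m = if n ℕ.≡ᵇ 1 then (toℕ i ≤ᵇ m) ∧ (m ≤ᵇ toℕ j) else inRange ns (suc m)

denom : (k : ℕ) → Series k
denom k = prodS (concatMap (λ i → concatMap (λ j → if toℕ i ≤ᵇ toℕ j then [ linFactor k i j ] else []) (LB.allFin k)) (LB.allFin k))

{-# OPTIONS --safe #-}
-- Let N(P) be the number of standard paths ending in P and F_{a,ℓ} = Σ_P N(P) x_{a+1}^{p₁}⋯x_{a+ℓ}^{p_ℓ}, the sum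
-- over compositions with ℓ parts. Deleting the last step of the paths ending in P = (p₁,…,p_ℓ) gives
--   N(P) + [P = (1,…,1)] N(p₂,…,p_ℓ) = [p₁ = 1] N(p₂,…,p_ℓ) + [p_ℓ = 1] N(p₁,…,p_{ℓ-1}) + Σ_i N(P − e_i),
-- the bracket on the left compensating for (1,…,1) arising from its predecessor both by prepending and by
-- appending a part 1. For generating functions this says
--   F_{a,ℓ+1} (1 − x_{a+1} − ⋯ − x_{a+ℓ+1}) = x_{a+1} F_{a+1,ℓ} + x_{a+ℓ+1} F_{a,ℓ} − N(1^ℓ) x_{a+1}⋯x_{a+ℓ+1},
-- so by induction on ℓ, F_{a,ℓ} times the factors 1 − x_i − ⋯ − x_j with a < i ≤ j ≤ a + ℓ is a polynomial.
-- For a = 0 and ℓ = k this is f_k times the denominator, and it is divisible by x₁⋯x_k since f_k is.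
module Submission where

open import Defs
open import Data.Bool using (Bool; true; false; if_then_else_; _∧_; _∨_; T)
open import Data.Bool.ListAction using () renaming (all to allᵇ; any to anyᵇ)
open import Data.Bool.Properties using (∧-zeroʳ; ∧-identityʳ; ∧-distribˡ-∨; ∨-identityʳ; T-∧)
open import Data.Fin using (Fin; toℕ; fromℕ<)
import Data.Fin.Properties as FP
open import Data.Integer as ℤ using (ℤ; +_; -_; _+_; _*_; _-_; 0ℤ; 1ℤ; -1ℤ)
import Data.Integer.Properties as ℤP
open import Data.Integer.Solver using (module +-*-Solver)
open import Data.List as L
  using (List; []; _∷_; _++_; _∷ʳ_; _∷ʳ′_; [_]; map; concatMap; upTo; filter; length; deduplicate)
import Data.List.Properties as LP
open import Data.List.Membership.Propositional using (_∈_)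
import Data.List.Membership.Propositional.Properties as MP
open import Data.List.Relation.Binary.Permutation.Propositional using (_↭_)
  renaming (refl to ↭-refl; prep to ↭-prep; swap to ↭-swap; trans to ↭-trans)
import Data.List.Relation.Binary.Permutation.Propositional.Properties as PermP
open import Data.List.Relation.Unary.All as All using (All; []; _∷_)
import Data.List.Relation.Unary.All.Properties as AP
open import Data.List.Relation.Unary.Any as Any using (here; there)
open import Data.Nat as ℕ using (ℕ; zero; suc; _∸_; _≤ᵇ_; _≡ᵇ_; _≤_; _<_; z≤n; s≤s)
open import Data.Nat.ListAction using () renaming (sum to sumℕ)
open import Data.Nat.ListAction.Properties using (sum-++)
import Data.Nat.Properties as ℕP
open import Data.Product using (Σ; _×_; _,_; proj₁; proj₂; swap)
open import Data.Sum using (inj₁; inj₂)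
open import Data.Vec as V using ([]; _∷_; zipWith)
import Data.Vec.Properties as VP
open import Data.Vec.Relation.Binary.Pointwise.Inductive using (Pointwise; []; _∷_)
open import Function using (_∘_)
open import Function.Bundles using (_⇔_; mk⇔; module Equivalence)
open import Relation.Binary.Definitions using (DecidableEquality; tri<; tri≈; tri>)
open import Relation.Binary.PropositionalEquality hiding ([_])
open import Relation.Nullary using (¬_; ¬?; Dec; contradiction; yes; no; does)
open import Relation.Nullary.Decidable using (_×-dec_; dec-true; dec-false; does-⇔)
open import Relation.Unary using (Pred; Decidable)
open import Algebra.Properties.CommutativeSemigroup ℤP.*-commutativeSemigroup using (x∙yz≈y∙xz)
open import Algebra.Properties.CommutativeSemigroup ℤP.+-commutativeSemigroup
  using () renaming (interchange to ℤ-interchange)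
open import Algebra.Properties.CommutativeSemigroup ℕP.+-commutativeSemigroup
  using () renaming (interchange to ℕ-interchange)

open +-*-Solver
open ≡-Reasoning

-- Finite sums

≤ᵇ-true : ∀ {m n} → m ≤ n → (m ≤ᵇ n) ≡ true
≤ᵇ-true m≤n = dec-true (_ ℕ.≤? _) m≤n

≤ᵇ-false : ∀ {m n} → n < m → (m ≤ᵇ n) ≡ false
≤ᵇ-false n<m = dec-false (_ ℕ.≤? _) (ℕP.<⇒≱ n<m)

∑ : {A : Set} → List A → (A → ℤ) → ℤ
∑ xs f = sumℤ (map f xs)

syntax ∑ xs (λ x → t) = ∑[ x ∈ xs ] t

∑-++ : ∀ {A : Set} (f : A → ℤ) xs ys → ∑ (xs ++ ys) f ≡ ∑ xs f + ∑ ys f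
∑-++ f []       ys = sym (ℤP.+-identityˡ _)
∑-++ f (x ∷ xs) ys = trans (cong (_+_ (f x)) (∑-++ f xs ys)) (sym (ℤP.+-assoc (f x) _ _))

∑-concatMap : ∀ {A B : Set} (f : B → ℤ) (g : A → List B) xs →
  ∑ (concatMap g xs) f ≡ ∑[ x ∈ xs ] ∑ (g x) f
∑-concatMap f g []       = refl
∑-concatMap f g (x ∷ xs) = trans (∑-++ f (g x) (concatMap g xs)) (cong (_+_ (∑ (g x) f)) (∑-concatMap f g xs))

∑-cong : ∀ {A : Set} {f g : A → ℤ} xs → (∀ x → f x ≡ g x) → ∑ xs f ≡ ∑ xs g
∑-cong xs f≗g = cong sumℤ (LP.map-cong f≗g xs)

∑-congᴬ : ∀ {A : Set} {f g : A → ℤ} {xs} → All (λ x → f x ≡ g x) xs → ∑ xs f ≡ ∑ xs g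
∑-congᴬ []         = refl
∑-congᴬ (px ∷ pxs) = cong₂ _+_ px (∑-congᴬ pxs)

∑-zero : ∀ {A : Set} (xs : List A) → ∑[ x ∈ xs ] 0ℤ ≡ 0ℤ
∑-zero []       = refl
∑-zero (x ∷ xs) = trans (ℤP.+-identityˡ _) (∑-zero xs)

∑-+ : ∀ {A : Set} (f g : A → ℤ) xs → ∑[ x ∈ xs ] (f x + g x) ≡ ∑ xs f + ∑ xs g
∑-+ f g []       = refl
∑-+ f g (x ∷ xs) = begin
  f x + g x + ∑[ x ∈ xs ] (f x + g x)  ≡⟨ cong (_+_ (f x + g x)) (∑-+ f g xs) ⟩
  f x + g x + (∑ xs f + ∑ xs g)        ≡⟨ ℤ-interchange (f x) (g x) (∑ xs f) (∑ xs g) ⟩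
  f x + ∑ xs f + (g x + ∑ xs g)        ∎

∑-*ˡ : ∀ {A : Set} c (f : A → ℤ) xs → ∑[ x ∈ xs ] (c * f x) ≡ c * ∑ xs f
∑-*ˡ c f []       = sym (ℤP.*-zeroʳ c)
∑-*ˡ c f (x ∷ xs) = trans (cong (_+_ (c * f x)) (∑-*ˡ c f xs)) (sym (ℤP.*-distribˡ-+ c (f x) _))

∑-neg : ∀ {A : Set} (f : A → ℤ) xs → ∑[ x ∈ xs ] (- f x) ≡ - ∑ xs f
∑-neg f []       = refl
∑-neg f (x ∷ xs) = trans (cong (_+_ (- f x)) (∑-neg f xs)) (sym (ℤP.neg-distrib-+ (f x) _))

∑-swap : ∀ {A B : Set} (φ : A → B → ℤ) xs ys →
  ∑[ x ∈ xs ] ∑[ y ∈ ys ] φ x y ≡ ∑[ y ∈ ys ] ∑[ x ∈ xs ] φ x y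
∑-swap φ []       ys = sym (∑-zero ys)
∑-swap φ (x ∷ xs) ys = trans (cong (_+_ (∑ ys (φ x))) (∑-swap φ xs ys)) (sym (∑-+ (φ x) _ ys))

∑≤ : ℕ → (ℕ → ℤ) → ℤ
∑≤ n χ = ∑ (upTo (suc n)) χ

syntax ∑≤ n (λ i → t) = ∑[ i ≤ n ] t

∑≤-snoc : ∀ n χ → ∑≤ (suc n) χ ≡ ∑≤ n χ + χ (suc n)
∑≤-snoc n χ = begin
  ∑ (upTo (suc (suc n))) χ         ≡⟨ cong (λ is → ∑ is χ) (sym (LP.upTo-∷ʳ (suc n))) ⟩
  ∑ (upTo (suc n) ++ [ suc n ]) χ  ≡⟨ ∑-++ χ (upTo (suc n)) _ ⟩
  ∑≤ n χ + (χ (suc n) + 0ℤ)        ≡⟨ cong (_+_ (∑≤ n χ)) (ℤP.+-identityʳ _) ⟩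
  ∑≤ n χ + χ (suc n)               ∎

∑≤-cons : ∀ n χ → ∑≤ (suc n) χ ≡ χ 0 + ∑[ i ≤ n ] χ (suc i)
∑≤-cons n χ = cong (_+_ (χ 0)) (cong sumℤ
  (trans (LP.map-applyUpTo suc χ (suc n)) (sym (LP.map-upTo (λ i → χ (suc i)) (suc n)))))

∑≤-cong : ∀ n {χ ψ : ℕ → ℤ} → (∀ i → i ≤ n → χ i ≡ ψ i) → ∑≤ n χ ≡ ∑≤ n ψ
∑≤-cong zero    χ≗ψ = cong (_+ 0ℤ) (χ≗ψ 0 z≤n)
∑≤-cong (suc n) {χ} {ψ} χ≗ψ = begin
  ∑≤ (suc n) χ        ≡⟨ ∑≤-snoc n χ ⟩
  ∑≤ n χ + χ (suc n)  ≡⟨ cong₂ _+_ (∑≤-cong n (λ i i≤n → χ≗ψ i (ℕP.m≤n⇒m≤1+n i≤n))) (χ≗ψ (suc n) ℕP.≤-refl) ⟩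
  ∑≤ n ψ + ψ (suc n)  ≡⟨ ∑≤-snoc n ψ ⟨
  ∑≤ (suc n) ψ        ∎

∑≤-vanishes : ∀ n {χ : ℕ → ℤ} → (∀ i → i ≤ n → χ i ≡ 0ℤ) → ∑≤ n χ ≡ 0ℤ
∑≤-vanishes n χ≗0 = trans (∑≤-cong n χ≗0) (∑-zero (upTo (suc n)))

∑≤-reverse : ∀ n χ → ∑≤ n χ ≡ ∑[ i ≤ n ] χ (n ∸ i)
∑≤-reverse zero    χ = refl
∑≤-reverse (suc n) χ = begin
  ∑≤ (suc n) χ
    ≡⟨ ∑≤-cons n χ ⟩
  χ 0 + ∑[ i ≤ n ] χ (suc i)
    ≡⟨ cong (_+_ (χ 0)) (∑≤-reverse n (λ i → χ (suc i))) ⟩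
  χ 0 + ∑[ i ≤ n ] χ (suc (n ∸ i))
    ≡⟨ cong (_+_ (χ 0)) (∑≤-cong n (λ i i≤n → cong χ (sym (ℕP.+-∸-assoc 1 i≤n)))) ⟩
  χ 0 + ∑[ i ≤ n ] χ (suc n ∸ i)
    ≡⟨ ℤP.+-comm (χ 0) _ ⟩
  ∑[ i ≤ n ] χ (suc n ∸ i) + χ 0
    ≡⟨ cong (λ m → ∑[ i ≤ n ] χ (suc n ∸ i) + χ m) (sym (ℕP.n∸n≡0 n)) ⟩
  ∑[ i ≤ n ] χ (suc n ∸ i) + χ (suc n ∸ suc n)
    ≡⟨ ∑≤-snoc n (λ i → χ (suc n ∸ i)) ⟨
  ∑[ i ≤ suc n ] χ (suc n ∸ i) ∎

truncate≤ : ℕ → (ℕ → ℤ) → ℕ → ℤ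
truncate≤ m χ j = if j ≤ᵇ m then χ j else 0ℤ

∑≤-truncate : ∀ m n χ → m ≤ n → ∑≤ m χ ≡ ∑≤ n (truncate≤ m χ)
∑≤-truncate zero zero χ z≤n = refl
∑≤-truncate m (suc n) χ m≤1+n with ℕP.m≤n⇒m<n∨m≡n m≤1+n
... | inj₁ (s≤s m≤n) = begin
  ∑≤ m χ
    ≡⟨ ∑≤-truncate m n χ m≤n ⟩
  ∑≤ n (truncate≤ m χ)
    ≡⟨ ℤP.+-identityʳ _ ⟨
  ∑≤ n (truncate≤ m χ) + 0ℤ
    ≡⟨ cong (λ b → ∑≤ n (truncate≤ m χ) + (if b then χ (suc n) else 0ℤ))
             (≤ᵇ-false (s≤s m≤n)) ⟨
  ∑≤ n (truncate≤ m χ) + truncate≤ m χ (suc n)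
    ≡⟨ ∑≤-snoc n (truncate≤ m χ) ⟨
  ∑≤ (suc n) (truncate≤ m χ) ∎
... | inj₂ refl = ∑≤-cong (suc n) (λ j j≤m → cong (λ b → if b then χ j else 0ℤ) (sym (≤ᵇ-true j≤m)))

m≤ᵇo∸n≡m+n≤ᵇo : ∀ i n j → i ≤ n → (j ≤ᵇ n ∸ i) ≡ (j ℕ.+ i ≤ᵇ n)
m≤ᵇo∸n≡m+n≤ᵇo i n j i≤n = does-⇔ (mk⇔ (ℕP.m≤o∸n⇒m+n≤o j i≤n) (ℕP.m+n≤o⇒m≤o∸n j)) (j ℕ.≤? n ∸ i) (j ℕ.+ i ℕ.≤? n)

∑≤-triangle-as-square : ∀ n (ψ : ℕ → ℕ → ℤ) →
  ∑[ i ≤ n ] ∑≤ (n ∸ i) (ψ i) ≡ ∑[ i ≤ n ] ∑[ j ≤ n ] (if j ℕ.+ i ≤ᵇ n then ψ i j else 0ℤ)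
∑≤-triangle-as-square n ψ = ∑≤-cong n (λ i i≤n → trans (∑≤-truncate (n ∸ i) n (ψ i) (ℕP.m∸n≤m n i))
  (∑-cong (upTo (suc n)) (λ j → cong (λ b → if b then ψ i j else 0ℤ) (m≤ᵇo∸n≡m+n≤ᵇo i n j i≤n))))

∑≤-triangle : ∀ n (ψ : ℕ → ℕ → ℤ) → ∑[ i ≤ n ] ∑≤ (n ∸ i) (ψ i) ≡ ∑[ j ≤ n ] ∑[ i ≤ n ∸ j ] ψ i j
∑≤-triangle n ψ = begin
  ∑[ i ≤ n ] ∑≤ (n ∸ i) (ψ i)
    ≡⟨ ∑≤-triangle-as-square n ψ ⟩
  ∑[ i ≤ n ] ∑[ j ≤ n ] (if j ℕ.+ i ≤ᵇ n then ψ i j else 0ℤ)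
    ≡⟨ ∑-swap (λ i j → if j ℕ.+ i ≤ᵇ n then ψ i j else 0ℤ) (upTo (suc n)) (upTo (suc n)) ⟩
  ∑[ j ≤ n ] ∑[ i ≤ n ] (if j ℕ.+ i ≤ᵇ n then ψ i j else 0ℤ)
    ≡⟨ ∑≤-cong n (λ j _ → ∑≤-cong n (λ i _ →
          cong (λ s → if s ≤ᵇ n then ψ i j else 0ℤ) (ℕP.+-comm j i))) ⟩
  ∑[ j ≤ n ] ∑[ i ≤ n ] (if i ℕ.+ j ≤ᵇ n then ψ i j else 0ℤ)
    ≡⟨ ∑≤-triangle-as-square n (λ j i → ψ i j) ⟨
  ∑[ j ≤ n ] ∑[ i ≤ n ∸ j ] ψ i j ∎

∑≤-delta : ∀ n c (χ : ℕ → ℤ) → (∀ i → i ≢ c → χ i ≡ 0ℤ) → ∑≤ n χ ≡ (if c ≤ᵇ n then χ c else 0ℤ)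
∑≤-delta zero zero    χ χ≗0 = ℤP.+-identityʳ _
∑≤-delta zero (suc c) χ χ≗0 = cong (_+ 0ℤ) (χ≗0 0 (λ ()))
∑≤-delta (suc n) c χ χ≗0 with ℕP.<-cmp c (suc n)
... | tri< (s≤s c≤n) _ _ = begin
  ∑≤ (suc n) χ                       ≡⟨ ∑≤-snoc n χ ⟩
  ∑≤ n χ + χ (suc n)                 ≡⟨ cong₂ _+_ (∑≤-delta n c χ χ≗0) (χ≗0 (suc n) (ℕP.<⇒≢ (s≤s c≤n) ∘ sym)) ⟩
  (if c ≤ᵇ n then χ c else 0ℤ) + 0ℤ  ≡⟨ ℤP.+-identityʳ _ ⟩
  (if c ≤ᵇ n then χ c else 0ℤ)       ≡⟨ cong (λ b → if b then χ c else 0ℤ)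
                                           (trans (≤ᵇ-true c≤n) (sym (≤ᵇ-true (ℕP.m≤n⇒m≤1+n c≤n)))) ⟩
  (if c ≤ᵇ suc n then χ c else 0ℤ)   ∎
... | tri≈ _ refl _ = begin
  ∑≤ (suc n) χ        ≡⟨ ∑≤-snoc n χ ⟩
  ∑≤ n χ + χ (suc n)  ≡⟨ cong (_+ χ (suc n)) (∑≤-vanishes n (λ i i≤n → χ≗0 i (ℕP.<⇒≢ (s≤s i≤n)))) ⟩
  0ℤ + χ (suc n)      ≡⟨ ℤP.+-identityˡ _ ⟩
  χ (suc n)           ≡⟨ cong (λ b → if b then χ (suc n) else 0ℤ) (≤ᵇ-true (ℕP.≤-refl {suc n})) ⟨
  (if suc n ≤ᵇ suc n then χ (suc n) else 0ℤ) ∎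
... | tri> _ _ c>1+n = begin
  ∑≤ (suc n) χ  ≡⟨ ∑≤-vanishes (suc n) (λ i i≤1+n → χ≗0 i (ℕP.<⇒≢ (ℕP.≤-<-trans i≤1+n c>1+n))) ⟩
  0ℤ            ≡⟨ cong (λ b → if b then χ c else 0ℤ) (≤ᵇ-false c>1+n) ⟨
  (if c ≤ᵇ suc n then χ c else 0ℤ) ∎

-- Formal power series

_∸ᵛ_ : ∀ {k} → Exp k → Exp k → Exp k
e ∸ᵛ a = zipWith _∸_ e a

infix 4 _≼_ _≼ᵇ_

_≼_ : ∀ {k} → Exp k → Exp k → Set
_≼_ = Pointwise _≤_

_≼ᵇ_ : ∀ {k} → Exp k → Exp k → Bool
[]       ≼ᵇ []       = true
(x ∷ xs) ≼ᵇ (y ∷ ys) = (x ≤ᵇ y) ∧ (xs ≼ᵇ ys)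

∑≼ : ∀ {k} → Exp k → (Exp k → ℤ) → ℤ
∑≼ e φ = ∑ (below e) φ

syntax ∑≼ e (λ a → t) = ∑[ a ≼ e ] t

∑≼-cons : ∀ {k} n (e : Exp k) φ → ∑≼ (n ∷ e) φ ≡ ∑[ i ≤ n ] ∑[ a ≼ e ] φ (i ∷ a)
∑≼-cons n e φ = trans (∑-concatMap φ (λ i → map (i ∷_) (below e)) (upTo (suc n)))
  (∑-cong (upTo (suc n)) (λ i → cong sumℤ (sym (LP.map-∘ (below e)))))

∑≼-cong : ∀ {k} (e : Exp k) {φ ψ} → (∀ a → a ≼ e → φ a ≡ ψ a) → ∑≼ e φ ≡ ∑≼ e ψ
∑≼-cong []      φ≗ψ = cong (_+ 0ℤ) (φ≗ψ [] [])
∑≼-cong (n ∷ e) {φ} {ψ} φ≗ψ = begin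
  ∑≼ (n ∷ e) φ                     ≡⟨ ∑≼-cons n e φ ⟩
  ∑[ i ≤ n ] ∑[ a ≼ e ] φ (i ∷ a)  ≡⟨ ∑≤-cong n (λ i i≤n → ∑≼-cong e (λ a a≼e → φ≗ψ (i ∷ a) (i≤n ∷ a≼e))) ⟩
  ∑[ i ≤ n ] ∑[ a ≼ e ] ψ (i ∷ a)  ≡⟨ ∑≼-cons n e ψ ⟨
  ∑≼ (n ∷ e) ψ                     ∎

∑≼-vanishes : ∀ {k} (e : Exp k) {φ} → (∀ a → a ≼ e → φ a ≡ 0ℤ) → ∑≼ e φ ≡ 0ℤ
∑≼-vanishes e φ≗0 = trans (∑≼-cong e φ≗0) (∑-zero (below e))

∑≼-reverse : ∀ {k} (e : Exp k) φ → ∑≼ e φ ≡ ∑[ a ≼ e ] φ (e ∸ᵛ a)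
∑≼-reverse []      φ = refl
∑≼-reverse (n ∷ e) φ = begin
  ∑≼ (n ∷ e) φ
    ≡⟨ ∑≼-cons n e φ ⟩
  ∑[ i ≤ n ] ∑[ a ≼ e ] φ (i ∷ a)
    ≡⟨ ∑-cong (upTo (suc n)) (λ i → ∑≼-reverse e (λ a → φ (i ∷ a))) ⟩
  ∑[ i ≤ n ] ∑[ a ≼ e ] φ (i ∷ (e ∸ᵛ a))
    ≡⟨ ∑≤-reverse n (λ i → ∑[ a ≼ e ] φ (i ∷ (e ∸ᵛ a))) ⟩
  ∑[ i ≤ n ] ∑[ a ≼ e ] φ ((n ∸ i) ∷ (e ∸ᵛ a))
    ≡⟨ ∑≼-cons n e (λ a → φ ((n ∷ e) ∸ᵛ a)) ⟨
  ∑[ a ≼ n ∷ e ] φ ((n ∷ e) ∸ᵛ a) ∎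

∑≼-triangle : ∀ {k} (e : Exp k) (φ : Exp k → Exp k → ℤ) →
  ∑[ a ≼ e ] ∑≼ (e ∸ᵛ a) (φ a) ≡ ∑[ b ≼ e ] ∑[ a ≼ e ∸ᵛ b ] φ a b
∑≼-triangle []      φ = refl
∑≼-triangle (n ∷ e) φ = begin
  ∑[ a ≼ n ∷ e ] ∑≼ ((n ∷ e) ∸ᵛ a) (φ a)
    ≡⟨ split φ ⟩
  ∑[ i ≤ n ] ∑[ j ≤ n ∸ i ] ∑[ a ≼ e ] ∑[ b ≼ e ∸ᵛ a ] φ (i ∷ a) (j ∷ b)
    ≡⟨ ∑≤-cong n (λ i _ → ∑≤-cong (n ∸ i) (λ j _ →
         ∑≼-triangle e (λ a b → φ (i ∷ a) (j ∷ b)))) ⟩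
  ∑[ i ≤ n ] ∑[ j ≤ n ∸ i ] ∑[ b ≼ e ] ∑[ a ≼ e ∸ᵛ b ] φ (i ∷ a) (j ∷ b)
    ≡⟨ ∑≤-triangle n (λ i j → ∑[ b ≼ e ] ∑[ a ≼ e ∸ᵛ b ] φ (i ∷ a) (j ∷ b)) ⟩
  ∑[ j ≤ n ] ∑[ i ≤ n ∸ j ] ∑[ b ≼ e ] ∑[ a ≼ e ∸ᵛ b ] φ (i ∷ a) (j ∷ b)
    ≡⟨ split (λ b a → φ a b) ⟨
  ∑[ b ≼ n ∷ e ] ∑[ a ≼ (n ∷ e) ∸ᵛ b ] φ a b ∎
  where
  split : ∀ (ψ : Exp _ → Exp _ → ℤ) → ∑[ a ≼ n ∷ e ] ∑≼ ((n ∷ e) ∸ᵛ a) (ψ a)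
                                    ≡ ∑[ i ≤ n ] ∑[ j ≤ n ∸ i ] ∑[ a ≼ e ] ∑[ b ≼ e ∸ᵛ a ] ψ (i ∷ a) (j ∷ b)
  split ψ = begin
    ∑[ a ≼ n ∷ e ] ∑≼ ((n ∷ e) ∸ᵛ a) (ψ a)
      ≡⟨ ∑≼-cons n e _ ⟩
    ∑[ i ≤ n ] ∑[ a ≼ e ] ∑≼ ((n ∸ i) ∷ (e ∸ᵛ a)) (ψ (i ∷ a))
      ≡⟨ ∑-cong (upTo (suc n)) (λ i → ∑-cong (below e) (λ a →
         ∑≼-cons (n ∸ i) (e ∸ᵛ a) _)) ⟩
    ∑[ i ≤ n ] ∑[ a ≼ e ] ∑[ j ≤ n ∸ i ] ∑[ b ≼ e ∸ᵛ a ] ψ (i ∷ a) (j ∷ b)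
      ≡⟨ ∑-cong (upTo (suc n)) (λ i → ∑-swap _ (below e) (upTo (suc (n ∸ i)))) ⟩
    ∑[ i ≤ n ] ∑[ j ≤ n ∸ i ] ∑[ a ≼ e ] ∑[ b ≼ e ∸ᵛ a ] ψ (i ∷ a) (j ∷ b) ∎

∑≼-delta : ∀ {k} (e c : Exp k) φ → (∀ a → a ≢ c → φ a ≡ 0ℤ) → ∑≼ e φ ≡ (if c ≼ᵇ e then φ c else 0ℤ)
∑≼-delta []      []      φ φ≗0 = ℤP.+-identityʳ _
∑≼-delta (n ∷ e) (c ∷ cs) φ φ≗0 = begin
  ∑≼ (n ∷ e) φ
    ≡⟨ ∑≼-cons n e φ ⟩
  ∑[ i ≤ n ] ∑[ a ≼ e ] φ (i ∷ a)
    ≡⟨ ∑≤-delta n c _ (λ i i≢c → ∑≼-vanishes e (λ a _ →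
         φ≗0 (i ∷ a) (i≢c ∘ cong V.head))) ⟩
  (if c ≤ᵇ n then ∑[ a ≼ e ] φ (c ∷ a) else 0ℤ)
    ≡⟨ cong (λ t → if c ≤ᵇ n then t else 0ℤ)
         (∑≼-delta e cs _ (λ a a≢cs → φ≗0 (c ∷ a) (a≢cs ∘ cong V.tail))) ⟩
  (if c ≤ᵇ n then (if cs ≼ᵇ e then φ (c ∷ cs) else 0ℤ) else 0ℤ)
    ≡⟨ if-∧ (c ≤ᵇ n) ⟩
  (if (c ≤ᵇ n) ∧ (cs ≼ᵇ e) then φ (c ∷ cs) else 0ℤ) ∎
  where
  if-∧ : ∀ b → (if b then (if cs ≼ᵇ e then φ (c ∷ cs) else 0ℤ) else 0ℤ) ≡ (if b ∧ (cs ≼ᵇ e) then φ (c ∷ cs) else 0ℤ)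
  if-∧ true  = refl
  if-∧ false = refl

∸ᵛ-involutive : ∀ {k} {a e : Exp k} → a ≼ e → e ∸ᵛ (e ∸ᵛ a) ≡ a
∸ᵛ-involutive []            = refl
∸ᵛ-involutive (x≤y ∷ xs≼ys) = cong₂ _∷_ (ℕP.m∸[m∸n]≡n x≤y) (∸ᵛ-involutive xs≼ys)

∸ᵛ-comm : ∀ {k} (e a b : Exp k) → (e ∸ᵛ a) ∸ᵛ b ≡ (e ∸ᵛ b) ∸ᵛ a
∸ᵛ-comm []      []      []      = refl
∸ᵛ-comm (x ∷ e) (y ∷ a) (z ∷ b) = cong₂ _∷_ ∸-comm (∸ᵛ-comm e a b)
  where
  ∸-comm : (x ∸ y) ∸ z ≡ (x ∸ z) ∸ y
  ∸-comm = trans (ℕP.∸-+-assoc x y z) (trans (cong (x ∸_) (ℕP.+-comm y z)) (sym (ℕP.∸-+-assoc x z y)))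

⋆-comm : ∀ {k} (F G : Series k) → F ⋆ G ≗ G ⋆ F
⋆-comm F G e = begin
  ∑[ a ≼ e ] (F a * G (e ∸ᵛ a))
    ≡⟨ ∑≼-reverse e _ ⟩
  ∑[ a ≼ e ] (F (e ∸ᵛ a) * G (e ∸ᵛ (e ∸ᵛ a)))
    ≡⟨ ∑≼-cong e (λ a a≼e → trans (cong (λ b → F (e ∸ᵛ a) * G b) (∸ᵛ-involutive a≼e))
                                    (ℤP.*-comm (F (e ∸ᵛ a)) (G a))) ⟩
  ∑[ a ≼ e ] (G a * F (e ∸ᵛ a)) ∎

⋆-cong : ∀ {k} {F F′ G G′ : Series k} → F ≗ F′ → G ≗ G′ → F ⋆ G ≗ F′ ⋆ G′
⋆-cong F≗F′ G≗G′ e = ∑-cong (below e) (λ a → cong₂ _*_ (F≗F′ a) (G≗G′ (e ∸ᵛ a)))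

⋆-congˡ : ∀ {k} {F F′ : Series k} (G : Series k) → F ≗ F′ → F ⋆ G ≗ F′ ⋆ G
⋆-congˡ {F′ = F′} G F≗F′ = ⋆-cong {F′ = F′} {G} F≗F′ (λ _ → refl)

⋆-congʳ : ∀ {k} (F : Series k) {G G′ : Series k} → G ≗ G′ → F ⋆ G ≗ F ⋆ G′
⋆-congʳ F {G′ = G′} = ⋆-cong {F = F} {G′ = G′} (λ _ → refl)

⋆-leftComm : ∀ {k} (F G H : Series k) → F ⋆ (G ⋆ H) ≗ G ⋆ (F ⋆ H)
⋆-leftComm F G H e = begin
  ∑[ a ≼ e ] (F a * ∑[ b ≼ e ∸ᵛ a ] (G b * H ((e ∸ᵛ a) ∸ᵛ b)))
    ≡⟨ ∑-cong (below e) (λ a → ∑-*ˡ (F a) _ (below (e ∸ᵛ a))) ⟨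
  ∑[ a ≼ e ] ∑[ b ≼ e ∸ᵛ a ] (F a * (G b * H ((e ∸ᵛ a) ∸ᵛ b)))
    ≡⟨ ∑≼-triangle e _ ⟩
  ∑[ b ≼ e ] ∑[ a ≼ e ∸ᵛ b ] (F a * (G b * H ((e ∸ᵛ a) ∸ᵛ b)))
    ≡⟨ ∑-cong (below e) (λ b → ∑-cong (below (e ∸ᵛ b)) (λ a →
          trans (cong (λ c → F a * (G b * H c)) (∸ᵛ-comm e a b))
                (x∙yz≈y∙xz (F a) (G b) _))) ⟩
  ∑[ b ≼ e ] ∑[ a ≼ e ∸ᵛ b ] (G b * (F a * H ((e ∸ᵛ b) ∸ᵛ a)))
    ≡⟨ ∑-cong (below e) (λ b → ∑-*ˡ (G b) _ (below (e ∸ᵛ b))) ⟩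
  ∑[ b ≼ e ] (G b * ∑[ a ≼ e ∸ᵛ b ] (F a * H ((e ∸ᵛ b) ∸ᵛ a))) ∎

⋆-assoc : ∀ {k} (F G H : Series k) → (F ⋆ G) ⋆ H ≗ F ⋆ (G ⋆ H)
⋆-assoc F G H e = begin
  ((F ⋆ G) ⋆ H) e  ≡⟨ ⋆-comm (F ⋆ G) H e ⟩
  (H ⋆ (F ⋆ G)) e  ≡⟨ ⋆-leftComm H F G e ⟩
  (F ⋆ (H ⋆ G)) e  ≡⟨ ⋆-congʳ F (⋆-comm H G) e ⟩
  (F ⋆ (G ⋆ H)) e  ∎

infixl 6 _⊕_

_⊕_ : ∀ {k} → Series k → Series k → Series k
(F ⊕ G) e = F e + G e

⊖_ : ∀ {k} → Series k → Series k
(⊖ F) e = - F e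

⋆-distribʳ-⊕ : ∀ {k} (H F G : Series k) → (F ⊕ G) ⋆ H ≗ (F ⋆ H) ⊕ (G ⋆ H)
⋆-distribʳ-⊕ H F G e = trans (∑-cong (below e) (λ a → ℤP.*-distribʳ-+ (H (e ∸ᵛ a)) (F a) (G a))) (∑-+ _ _ (below e))

⋆-⊖ˡ : ∀ {k} (F G : Series k) → (⊖ F) ⋆ G ≗ ⊖ (F ⋆ G)
⋆-⊖ˡ F G e = trans (∑-cong (below e) (λ a → sym (ℤP.neg-distribˡ-* (F a) _))) (∑-neg _ (below e))

zeroᵛ : ∀ k → Exp k
zeroᵛ k = V.replicate k 0

⋆-monomial : ∀ {k} (M F : Series k) (c : Exp k) → (∀ a → a ≢ c → M a ≡ 0ℤ) →
  ∀ e → (M ⋆ F) e ≡ (if c ≼ᵇ e then M c * F (e ∸ᵛ c) else 0ℤ)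
⋆-monomial M F c M≗0 e = ∑≼-delta e c _ (λ a a≢c → cong (_* F (e ∸ᵛ a)) (M≗0 a a≢c))

oneS-supported : ∀ {k} (a : Exp k) → a ≢ zeroᵛ k → oneS a ≡ 0ℤ
oneS-supported []          a≢0 = contradiction refl a≢0
oneS-supported (zero ∷ a)  a≢0 = oneS-supported a (a≢0 ∘ cong (0 ∷_))
oneS-supported (suc _ ∷ a) _   = refl

zeroᵛ-≼ᵇ : ∀ {k} (e : Exp k) → (zeroᵛ k ≼ᵇ e) ≡ true
zeroᵛ-≼ᵇ []      = refl
zeroᵛ-≼ᵇ (_ ∷ e) = zeroᵛ-≼ᵇ e

oneS-zeroᵛ : ∀ k → oneS (zeroᵛ k) ≡ 1ℤ
oneS-zeroᵛ zero    = refl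
oneS-zeroᵛ (suc k) = oneS-zeroᵛ k

∸ᵛ-identityʳ : ∀ {k} (e : Exp k) → e ∸ᵛ zeroᵛ k ≡ e
∸ᵛ-identityʳ []      = refl
∸ᵛ-identityʳ (x ∷ e) = cong (x ∷_) (∸ᵛ-identityʳ e)

⋆-identityʳ : ∀ {k} (F : Series k) → F ⋆ oneS ≗ F
⋆-identityʳ {k} F e = begin
  (F ⋆ oneS) e
    ≡⟨ ⋆-comm F oneS e ⟩
  (oneS ⋆ F) e
    ≡⟨ ⋆-monomial oneS F (zeroᵛ k) oneS-supported e ⟩
  (if zeroᵛ k ≼ᵇ e then oneS (zeroᵛ k) * F (e ∸ᵛ zeroᵛ k) else 0ℤ)
    ≡⟨ cong (if_then oneS (zeroᵛ k) * F (e ∸ᵛ zeroᵛ k) else 0ℤ) (zeroᵛ-≼ᵇ e) ⟩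
  oneS (zeroᵛ k) * F (e ∸ᵛ zeroᵛ k)
    ≡⟨ cong₂ _*_ (oneS-zeroᵛ k) (cong F (∸ᵛ-identityʳ e)) ⟩
  1ℤ * F e
    ≡⟨ ℤP.*-identityˡ (F e) ⟩
  F e ∎

prodS-↭ : ∀ {k} {Fs Gs : List (Series k)} → Fs ↭ Gs → prodS Fs ≗ prodS Gs
prodS-↭ ↭-refl                    = λ _ → refl
prodS-↭ (↭-prep F Fs↭Gs)          = ⋆-congʳ F (prodS-↭ Fs↭Gs)
prodS-↭ (↭-swap {xs = Fs} F G Fs↭Gs) =
  λ e → trans (⋆-leftComm F G (prodS Fs) e) (⋆-congʳ G (⋆-congʳ F (prodS-↭ Fs↭Gs)) e)
prodS-↭ (↭-trans Fs↭Hs Hs↭Gs)     = λ e → trans (prodS-↭ Fs↭Hs e) (prodS-↭ Hs↭Gs e)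

deg : ∀ {k} → Exp k → ℕ
deg e = sumℕ (V.toList e)

deg-∸ᵛ : ∀ {k} {a e : Exp k} → a ≼ e → deg a ℕ.+ deg (e ∸ᵛ a) ≡ deg e
deg-∸ᵛ []            = refl
deg-∸ᵛ {a = x ∷ a} {y ∷ e} (x≤y ∷ a≼e) =
  trans (ℕ-interchange x (deg a) (y ∸ x) (deg (e ∸ᵛ a))) (cong₂ ℕ._+_ (ℕP.m+[n∸m]≡n x≤y) (deg-∸ᵛ a≼e))

isPolynomial-≗ : ∀ {k} {F G : Series k} → F ≗ G → IsPolynomial F → IsPolynomial G
isPolynomial-≗ F≗G (N , F-vanishes) = N , λ e N<deg → trans (sym (F≗G e)) (F-vanishes e N<deg)

isPolynomial-⊕ : ∀ {k} {F G : Series k} → IsPolynomial F → IsPolynomial G → IsPolynomial (F ⊕ G)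
isPolynomial-⊕ (N , F-vanishes) (M , G-vanishes) = N ℕ.+ M , λ e N+M<deg →
  cong₂ _+_ (F-vanishes e (ℕP.≤-<-trans (ℕP.m≤m+n N M) N+M<deg)) (G-vanishes e (ℕP.≤-<-trans (ℕP.m≤n+m M N) N+M<deg))

isPolynomial-⊖ : ∀ {k} {F : Series k} → IsPolynomial F → IsPolynomial (⊖ F)
isPolynomial-⊖ (N , F-vanishes) = N , λ e N<deg → cong -_ (F-vanishes e N<deg)

isPolynomial-⋆ : ∀ {k} {F G : Series k} → IsPolynomial F → IsPolynomial G → IsPolynomial (F ⋆ G)
isPolynomial-⋆ {F = F} {G} (N , F-vanishes) (M , G-vanishes) = N ℕ.+ M , λ e N+M<deg →
  ∑≼-vanishes e (λ a a≼e → term-vanishes a≼e N+M<deg)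
  where
  term-vanishes : ∀ {a e} → a ≼ e → N ℕ.+ M < deg e → F a * G (e ∸ᵛ a) ≡ 0ℤ
  term-vanishes {a} {e} a≼e N+M<deg with N ℕ.<? deg a
  ... | yes N<deg-a = cong (_* G (e ∸ᵛ a)) (F-vanishes a N<deg-a)
  ... | no  N≮deg-a = trans (cong (F a *_) (G-vanishes (e ∸ᵛ a) M<deg-rest)) (ℤP.*-zeroʳ (F a))
    where
    M<deg-rest : M < deg (e ∸ᵛ a)
    M<deg-rest = ℕP.+-cancelˡ-< (deg a) M (deg (e ∸ᵛ a))
      (ℕP.≤-<-trans (ℕP.+-monoˡ-≤ M (ℕP.≮⇒≥ N≮deg-a)) (subst (N ℕ.+ M <_) (sym (deg-∸ᵛ a≼e)) N+M<deg))

isPolynomial-monomial : ∀ {k} (M : Series k) (c : Exp k) → (∀ a → a ≢ c → M a ≡ 0ℤ) → IsPolynomial M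
isPolynomial-monomial M c M≗0 = deg c , λ e deg-c<deg-e → M≗0 e (λ e≡c → ℕP.<-irrefl (cong deg (sym e≡c)) deg-c<deg-e)

isPolynomial-prodS : ∀ {k} {Fs : List (Series k)} → All IsPolynomial Fs → IsPolynomial (prodS Fs)
isPolynomial-prodS []         = isPolynomial-monomial oneS (zeroᵛ _) oneS-supported
isPolynomial-prodS (pF ∷ pFs) = isPolynomial-⋆ pF (isPolynomial-prodS pFs)

-- Counting standard paths

𝟙 : Bool → ℤ
𝟙 b = if b then 1ℤ else 0ℤ

allOnes : List ℕ → Bool
allOnes = allᵇ (_≡ᵇ 1)

𝟙-∧ : ∀ a b → 𝟙 (a ∧ b) ≡ 𝟙 a * 𝟙 b
𝟙-∧ true  b = sym (ℤP.*-identityˡ (𝟙 b))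
𝟙-∧ false b = refl

𝟙-false-* : ∀ {b} z → b ≡ false → 𝟙 b * z ≡ 0ℤ
𝟙-false-* z refl = refl

≡ᵇ-sym : ∀ m n → (m ≡ᵇ n) ≡ (n ≡ᵇ m)
≡ᵇ-sym m n = does-⇔ (mk⇔ sym sym) (m ℕ.≟ n) (n ℕ.≟ m)

⟦_≟_⟧ : Composition → Composition → ℤ
⟦ P ≟ Q ⟧ = 𝟙 (does (P ≟C Q))

⟦≟⟧-sym : ∀ P Q → ⟦ P ≟ Q ⟧ ≡ ⟦ Q ≟ P ⟧
⟦≟⟧-sym P Q = cong 𝟙 (does-⇔ (mk⇔ sym sym) (P ≟C Q) (Q ≟C P))

⟦≟⟧-≢ : ∀ {P Q} → P ≢ Q → ⟦ P ≟ Q ⟧ ≡ 0ℤ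
⟦≟⟧-≢ {P} {Q} P≢Q = cong 𝟙 (dec-false (P ≟C Q) P≢Q)

⟦∷≟∷⟧ : ∀ x y P Q → ⟦ x ∷ P ≟ y ∷ Q ⟧ ≡ 𝟙 (x ≡ᵇ y) * ⟦ P ≟ Q ⟧
⟦∷≟∷⟧ x y P Q = 𝟙-∧ (x ≡ᵇ y) (does (P ≟C Q))

⟦∷ʳ≟∷ʳ⟧ : ∀ P x Q y → ⟦ P ∷ʳ x ≟ Q ∷ʳ y ⟧ ≡ 𝟙 (x ≡ᵇ y) * ⟦ P ≟ Q ⟧
⟦∷ʳ≟∷ʳ⟧ P x Q y = trans (cong 𝟙 (does-⇔ snoc-injective ((P ∷ʳ x) ≟C (Q ∷ʳ y)) (x ℕ.≟ y ×-dec P ≟C Q))) (𝟙-∧ (x ≡ᵇ y) _)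
  where
  snoc-injective : P ∷ʳ x ≡ Q ∷ʳ y ⇔ (x ≡ y × P ≡ Q)
  snoc-injective = mk⇔ (λ eq → swap (LP.∷ʳ-injective P Q eq)) (λ { (refl , refl) → refl })

∷ʳ1≟1∷ : ∀ Xs → does ((Xs ∷ʳ 1) ≟C (1 ∷ Xs)) ≡ allOnes Xs
∷ʳ1≟1∷ []                 = refl
∷ʳ1≟1∷ (zero ∷ Xs)         = refl
∷ʳ1≟1∷ (suc zero ∷ Xs)     = ∷ʳ1≟1∷ Xs
∷ʳ1≟1∷ (suc (suc _) ∷ Xs)  = refl

length-filter : ∀ {A : Set} (f : A → Composition) P xs →
  + length (filter (λ x → f x ≟C P) xs) ≡ ∑[ x ∈ xs ] ⟦ f x ≟ P ⟧
length-filter f P []       = refl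
length-filter f P (x ∷ xs) with does (f x ≟C P)
... | true  = trans (ℤP.pos-+ 1 _) (cong (_+_ 1ℤ) (length-filter f P xs))
... | false = trans (length-filter f P xs) (sym (ℤP.+-identityˡ _))

∑-filter : ∀ {A : Set} {p} {Pr : Pred A p} (Pr? : Decidable Pr) (f : A → ℤ) xs →
  ∑ (filter Pr? xs) f ≡ ∑[ x ∈ xs ] (if does (Pr? x) then f x else 0ℤ)
∑-filter Pr? f []       = refl
∑-filter Pr? f (x ∷ xs) with does (Pr? x)
... | true  = cong (_+_ (f x)) (∑-filter Pr? f xs)
... | false = trans (∑-filter Pr? f xs) (sym (ℤP.+-identityˡ _))

_∈ᵇ_ : Composition → List Composition → Bool
P ∈ᵇ Qs = anyᵇ (λ Q → does (Q ≟C P)) Qs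

∑-deduplicate : ∀ P Qs → ∑[ Q ∈ deduplicate _≟C_ Qs ] ⟦ Q ≟ P ⟧ ≡ 𝟙 (P ∈ᵇ Qs)
∑-deduplicate P []       = refl
∑-deduplicate P (Q ∷ Qs) with Q ≟C P
... | yes refl = cong (_+_ 1ℤ) (begin
  ∑[ Q′ ∈ filter (¬? ∘ (P ≟C_)) (deduplicate _≟C_ Qs) ] ⟦ Q′ ≟ P ⟧
    ≡⟨ ∑-filter (¬? ∘ (P ≟C_)) _ (deduplicate _≟C_ Qs) ⟩
  ∑[ Q′ ∈ deduplicate _≟C_ Qs ] (if does (¬? (P ≟C Q′)) then ⟦ Q′ ≟ P ⟧ else 0ℤ)
    ≡⟨ ∑-cong (deduplicate _≟C_ Qs) removed ⟩
  ∑[ Q′ ∈ deduplicate _≟C_ Qs ] 0ℤ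
    ≡⟨ ∑-zero (deduplicate _≟C_ Qs) ⟩
  0ℤ ∎)
  where
  removed : ∀ Q′ → (if does (¬? (P ≟C Q′)) then ⟦ Q′ ≟ P ⟧ else 0ℤ) ≡ 0ℤ
  removed Q′ with P ≟C Q′
  ... | yes _   = refl
  ... | no P≢Q′ = ⟦≟⟧-≢ (P≢Q′ ∘ sym)
... | no Q≢P = begin
  0ℤ + ∑[ Q′ ∈ filter (¬? ∘ (Q ≟C_)) (deduplicate _≟C_ Qs) ] ⟦ Q′ ≟ P ⟧
    ≡⟨ ℤP.+-identityˡ _ ⟩
  ∑[ Q′ ∈ filter (¬? ∘ (Q ≟C_)) (deduplicate _≟C_ Qs) ] ⟦ Q′ ≟ P ⟧
    ≡⟨ ∑-filter (¬? ∘ (Q ≟C_)) _ (deduplicate _≟C_ Qs) ⟩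
  ∑[ Q′ ∈ deduplicate _≟C_ Qs ] (if does (¬? (Q ≟C Q′)) then ⟦ Q′ ≟ P ⟧ else 0ℤ)
    ≡⟨ ∑-cong (deduplicate _≟C_ Qs) kept ⟩
  ∑[ Q′ ∈ deduplicate _≟C_ Qs ] ⟦ Q′ ≟ P ⟧
    ≡⟨ ∑-deduplicate P Qs ⟩
  𝟙 (P ∈ᵇ Qs) ∎
  where
  kept : ∀ Q′ → (if does (¬? (Q ≟C Q′)) then ⟦ Q′ ≟ P ⟧ else 0ℤ) ≡ ⟦ Q′ ≟ P ⟧
  kept Q′ with Q ≟C Q′
  ... | yes refl = sym (⟦≟⟧-≢ Q≢P)
  ... | no _     = refl

decrements : Composition → List Composition
decrements []          = []
decrements (zero ∷ P)  = map (zero ∷_) (decrements P)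
decrements (suc p ∷ P) = (p ∷ P) ∷ map (suc p ∷_) (decrements P)

∑-map-∷ : ∀ p Qs r R → ∑[ Q ∈ map (p ∷_) Qs ] ⟦ Q ≟ r ∷ R ⟧ ≡ 𝟙 (p ≡ᵇ r) * ∑[ Q ∈ Qs ] ⟦ Q ≟ R ⟧
∑-map-∷ p Qs r R = trans (cong sumℤ (sym (LP.map-∘ Qs)))
  (trans (∑-cong Qs (λ Q → ⟦∷≟∷⟧ p r Q R)) (∑-*ˡ (𝟙 (p ≡ᵇ r)) _ Qs))

∑-map-∷-[] : ∀ p Qs → ∑[ Q ∈ map (p ∷_) Qs ] ⟦ Q ≟ [] ⟧ ≡ 0ℤ
∑-map-∷-[] p Qs = trans (cong sumℤ (sym (LP.map-∘ Qs))) (∑-zero Qs)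

∈ᵇ-map-∷ : ∀ r p P Qs → (p ∷ P) ∈ᵇ map (r ∷_) Qs ≡ (r ≡ᵇ p) ∧ (P ∈ᵇ Qs)
∈ᵇ-map-∷ r p P []       = sym (∧-zeroʳ (r ≡ᵇ p))
∈ᵇ-map-∷ r p P (Q ∷ Qs) = trans (cong ((r ≡ᵇ p) ∧ does (Q ≟C P) ∨_) (∈ᵇ-map-∷ r p P Qs))
  (sym (∧-distribˡ-∨ (r ≡ᵇ p) _ _))

[]-∈ᵇ-map-∷ : ∀ r Qs → [] ∈ᵇ map (r ∷_) Qs ≡ false
[]-∈ᵇ-map-∷ r []       = refl
[]-∈ᵇ-map-∷ r (Q ∷ Qs) = []-∈ᵇ-map-∷ r Qs

∈ᵇ-map-increments : ∀ r R p P → 𝟙 (P ∈ᵇ increments R) ≡ ∑[ Q ∈ decrements P ] ⟦ Q ≟ R ⟧ →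
  𝟙 ((p ∷ P) ∈ᵇ map (r ∷_) (increments R)) ≡ ∑[ Q ∈ map (p ∷_) (decrements P) ] ⟦ Q ≟ r ∷ R ⟧
∈ᵇ-map-increments r R p P P∈ᵇincrR = begin
  𝟙 ((p ∷ P) ∈ᵇ map (r ∷_) (increments R))      ≡⟨ cong 𝟙 (∈ᵇ-map-∷ r p P (increments R)) ⟩
  𝟙 ((r ≡ᵇ p) ∧ (P ∈ᵇ increments R))            ≡⟨ 𝟙-∧ (r ≡ᵇ p) _ ⟩
  𝟙 (r ≡ᵇ p) * 𝟙 (P ∈ᵇ increments R)            ≡⟨ cong₂ _*_ (cong 𝟙 (≡ᵇ-sym r p)) P∈ᵇincrR ⟩
  𝟙 (p ≡ᵇ r) * ∑[ Q ∈ decrements P ] ⟦ Q ≟ R ⟧  ≡⟨ ∑-map-∷ p (decrements P) r R ⟨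
  ∑[ Q ∈ map (p ∷_) (decrements P) ] ⟦ Q ≟ r ∷ R ⟧ ∎

∈ᵇ-increments : ∀ R P → 𝟙 (P ∈ᵇ increments R) ≡ ∑[ Q ∈ decrements P ] ⟦ Q ≟ R ⟧
∈ᵇ-increments []      []          = refl
∈ᵇ-increments []      (zero ∷ P)  = sym (∑-map-∷-[] zero (decrements P))
∈ᵇ-increments []      (suc p ∷ P) = sym (trans (ℤP.+-identityˡ _) (∑-map-∷-[] (suc p) (decrements P)))
∈ᵇ-increments (r ∷ R) []          = cong 𝟙 ([]-∈ᵇ-map-∷ r (increments R))
∈ᵇ-increments (r ∷ R) (zero ∷ P)  = ∈ᵇ-map-increments r R zero P (∈ᵇ-increments R P)
∈ᵇ-increments (r ∷ R) (suc p ∷ P) with r ℕ.≟ p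
... | yes refl = begin
  𝟙 (does ((r ∷ R) ≟C (r ∷ P)) ∨ ((suc r ∷ P) ∈ᵇ map (r ∷_) (increments R)))
    ≡⟨ cong (λ b → 𝟙 (does ((r ∷ R) ≟C (r ∷ P)) ∨ b))
            (trans (∈ᵇ-map-∷ r (suc r) P (increments R))
                   (cong (_∧ (P ∈ᵇ increments R)) (dec-false (r ℕ.≟ suc r) (ℕP.1+n≢n ∘ sym)))) ⟩
  𝟙 (does ((r ∷ R) ≟C (r ∷ P)) ∨ false)
    ≡⟨ cong 𝟙 (∨-identityʳ _) ⟩
  ⟦ r ∷ R ≟ r ∷ P ⟧
    ≡⟨ ⟦≟⟧-sym (r ∷ R) (r ∷ P) ⟩
  ⟦ r ∷ P ≟ r ∷ R ⟧
    ≡⟨ ℤP.+-identityʳ _ ⟨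
  ⟦ r ∷ P ≟ r ∷ R ⟧ + 0ℤ
    ≡⟨ cong (_+_ ⟦ r ∷ P ≟ r ∷ R ⟧) (𝟙-false-* _ (dec-false (suc r ℕ.≟ r) ℕP.1+n≢n)) ⟨
  ⟦ r ∷ P ≟ r ∷ R ⟧ + 𝟙 (suc r ≡ᵇ r) * ∑[ Q ∈ decrements P ] ⟦ Q ≟ R ⟧
    ≡⟨ cong (_+_ ⟦ r ∷ P ≟ r ∷ R ⟧) (∑-map-∷ (suc r) (decrements P) r R) ⟨
  ∑[ Q ∈ decrements (suc r ∷ P) ] ⟦ Q ≟ r ∷ R ⟧ ∎
... | no r≢p = begin
  𝟙 ((r ≡ᵇ p) ∧ does (R ≟C P) ∨ ((suc p ∷ P) ∈ᵇ map (r ∷_) (increments R)))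
    ≡⟨ cong (λ b → 𝟙 (b ∧ does (R ≟C P) ∨ ((suc p ∷ P) ∈ᵇ map (r ∷_) (increments R)))) (dec-false (r ℕ.≟ p) r≢p) ⟩
  𝟙 ((suc p ∷ P) ∈ᵇ map (r ∷_) (increments R))
    ≡⟨ ∈ᵇ-map-increments r R (suc p) P (∈ᵇ-increments R P) ⟩
  ∑[ Q ∈ map (suc p ∷_) (decrements P) ] ⟦ Q ≟ r ∷ R ⟧
    ≡⟨ ℤP.+-identityˡ _ ⟨
  0ℤ + ∑[ Q ∈ map (suc p ∷_) (decrements P) ] ⟦ Q ≟ r ∷ R ⟧
    ≡⟨ cong (_+ ∑[ Q ∈ map (suc p ∷_) (decrements P) ] ⟦ Q ≟ r ∷ R ⟧)
            (⟦≟⟧-≢ {p ∷ P} {r ∷ R} (r≢p ∘ sym ∘ proj₁ ∘ LP.∷-injective)) ⟨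
  ∑[ Q ∈ decrements (suc p ∷ P) ] ⟦ Q ≟ r ∷ R ⟧ ∎

increments-length : ∀ R → All (λ Q → length Q ≡ length R) (increments R)
increments-length []      = []
increments-length (r ∷ R) = refl ∷ AP.map⁺ (All.map (cong suc) (increments-length R))

∈ᵇ-increments-length : ∀ {R P} → length P ≢ length R → P ∈ᵇ increments R ≡ false
∈ᵇ-increments-length {R} {P} |P|≢|R| = notAmong (increments-length R)
  where
  notAmong : ∀ {Qs} → All (λ Q → length Q ≡ length R) Qs → P ∈ᵇ Qs ≡ false
  notAmong []                  = refl
  notAmong {Q ∷ _} (|Q|≡|R| ∷ rest) =
    cong₂ _∨_ (dec-false (Q ≟C P) (λ Q≡P → |P|≢|R| (trans (cong length (sym Q≡P)) |Q|≡|R|))) (notAmong rest)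

-- Increments of R are shorter than 1 ∷ R and R ∷ʳ 1, so only these two covers can coincide.
∑-covers : ∀ R P → ∑[ Q ∈ covers R ] ⟦ Q ≟ P ⟧ + ⟦ 1 ∷ R ≟ P ⟧ * ⟦ R ∷ʳ 1 ≟ P ⟧
                 ≡ ⟦ 1 ∷ R ≟ P ⟧ + ⟦ R ∷ʳ 1 ≟ P ⟧ + ∑[ Q ∈ decrements P ] ⟦ Q ≟ R ⟧
∑-covers R P = begin
  ∑[ Q ∈ covers R ] ⟦ Q ≟ P ⟧ + ⟦ 1 ∷ R ≟ P ⟧ * ⟦ R ∷ʳ 1 ≟ P ⟧
    ≡⟨ cong (_+ ⟦ 1 ∷ R ≟ P ⟧ * ⟦ R ∷ʳ 1 ≟ P ⟧) (∑-deduplicate P (coversRaw R)) ⟩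
  𝟙 (P ∈ᵇ coversRaw R) + ⟦ 1 ∷ R ≟ P ⟧ * ⟦ R ∷ʳ 1 ≟ P ⟧
    ≡⟨ inclusion–exclusion ((1 ∷ R) ≟C P) ((R ∷ʳ 1) ≟C P) ⟩
  ⟦ 1 ∷ R ≟ P ⟧ + ⟦ R ∷ʳ 1 ≟ P ⟧ + 𝟙 (P ∈ᵇ increments R)
    ≡⟨ cong (_+_ (⟦ 1 ∷ R ≟ P ⟧ + ⟦ R ∷ʳ 1 ≟ P ⟧)) (∈ᵇ-increments R P) ⟩
  ⟦ 1 ∷ R ≟ P ⟧ + ⟦ R ∷ʳ 1 ≟ P ⟧ + ∑[ Q ∈ decrements P ] ⟦ Q ≟ R ⟧ ∎
  where
  |R∷ʳ1| : length (R ∷ʳ 1) ≡ suc (length R)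
  |R∷ʳ1| = LP.length-++-comm R [ 1 ]
  inclusion–exclusion : (a : Dec (1 ∷ R ≡ P)) (b : Dec (R ∷ʳ 1 ≡ P)) →
    𝟙 (does a ∨ (does b ∨ P ∈ᵇ increments R)) + 𝟙 (does a) * 𝟙 (does b) ≡ 𝟙 (does a) + 𝟙 (does b) + 𝟙 (P ∈ᵇ increments R)
  inclusion–exclusion (yes refl) (yes _)   rewrite ∈ᵇ-increments-length {R} {1 ∷ R} ℕP.1+n≢n = refl
  inclusion–exclusion (yes refl) (no _)    rewrite ∈ᵇ-increments-length {R} {1 ∷ R} ℕP.1+n≢n = refl
  inclusion–exclusion (no _)     (yes refl) rewrite ∈ᵇ-increments-length {R} {R ∷ʳ 1} (ℕP.1+n≢n ∘ trans (sym |R∷ʳ1|)) = refl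
  inclusion–exclusion (no _)     (no _)    = trans (ℤP.+-identityʳ c) (sym (ℤP.+-identityˡ c))
    where c = 𝟙 (P ∈ᵇ increments R)

-- The covers 1 ∷ R and R ∷ʳ 1 coincide exactly when R consists of ones.
⟦1∷≟⟧*⟦∷ʳ1≟⟧ : ∀ R x Xs → ⟦ 1 ∷ R ≟ x ∷ Xs ⟧ * ⟦ R ∷ʳ 1 ≟ x ∷ Xs ⟧ ≡ 𝟙 (allOnes (x ∷ Xs)) * ⟦ R ≟ Xs ⟧
⟦1∷≟⟧*⟦∷ʳ1≟⟧ R x Xs with R ≟C Xs
... | no R≢Xs = begin
  𝟙 ((1 ≡ᵇ x) ∧ false) * ⟦ R ∷ʳ 1 ≟ x ∷ Xs ⟧  ≡⟨ cong (λ b → 𝟙 b * ⟦ R ∷ʳ 1 ≟ x ∷ Xs ⟧) (∧-zeroʳ (1 ≡ᵇ x)) ⟩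
  0ℤ                                          ≡⟨ ℤP.*-zeroʳ (𝟙 (allOnes (x ∷ Xs))) ⟨
  𝟙 (allOnes (x ∷ Xs)) * 0ℤ                   ∎
⟦1∷≟⟧*⟦∷ʳ1≟⟧ R zero              .R | yes refl = refl
⟦1∷≟⟧*⟦∷ʳ1≟⟧ R (suc (suc _))     .R | yes refl = refl
⟦1∷≟⟧*⟦∷ʳ1≟⟧ R (suc zero)        .R | yes refl = begin
  1ℤ * 𝟙 (does ((R ∷ʳ 1) ≟C (1 ∷ R)))  ≡⟨ ℤP.*-identityˡ _ ⟩
  𝟙 (does ((R ∷ʳ 1) ≟C (1 ∷ R)))       ≡⟨ cong 𝟙 (∷ʳ1≟1∷ R) ⟩
  𝟙 (allOnes R)                        ≡⟨ ℤP.*-identityʳ _ ⟨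
  𝟙 (allOnes R) * 1ℤ                   ∎

covers-count : ∀ R x Xs Ys y → x ∷ Xs ≡ Ys ∷ʳ y →
  ∑[ Q ∈ covers R ] ⟦ Q ≟ x ∷ Xs ⟧ + 𝟙 (allOnes (x ∷ Xs)) * ⟦ R ≟ Xs ⟧
    ≡ 𝟙 (x ≡ᵇ 1) * ⟦ R ≟ Xs ⟧ + 𝟙 (y ≡ᵇ 1) * ⟦ R ≟ Ys ⟧ + ∑[ Q ∈ decrements (x ∷ Xs) ] ⟦ Q ≟ R ⟧
covers-count R x Xs Ys y x∷Xs≡Ys∷ʳy = begin
  ∑[ Q ∈ covers R ] ⟦ Q ≟ P ⟧ + 𝟙 (allOnes P) * ⟦ R ≟ Xs ⟧
    ≡⟨ cong (_+_ (∑[ Q ∈ covers R ] ⟦ Q ≟ P ⟧)) (⟦1∷≟⟧*⟦∷ʳ1≟⟧ R x Xs) ⟨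
  ∑[ Q ∈ covers R ] ⟦ Q ≟ P ⟧ + ⟦ 1 ∷ R ≟ P ⟧ * ⟦ R ∷ʳ 1 ≟ P ⟧
    ≡⟨ ∑-covers R P ⟩
  ⟦ 1 ∷ R ≟ P ⟧ + ⟦ R ∷ʳ 1 ≟ P ⟧ + ∑[ Q ∈ decrements P ] ⟦ Q ≟ R ⟧
    ≡⟨ cong (λ t → t + ∑[ Q ∈ decrements P ] ⟦ Q ≟ R ⟧) (cong₂ _+_ head last) ⟩
  𝟙 (x ≡ᵇ 1) * ⟦ R ≟ Xs ⟧ + 𝟙 (y ≡ᵇ 1) * ⟦ R ≟ Ys ⟧ + ∑[ Q ∈ decrements P ] ⟦ Q ≟ R ⟧ ∎
  where
  P = x ∷ Xs
  head : ⟦ 1 ∷ R ≟ x ∷ Xs ⟧ ≡ 𝟙 (x ≡ᵇ 1) * ⟦ R ≟ Xs ⟧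
  head = trans (⟦∷≟∷⟧ 1 x R Xs) (cong (λ b → 𝟙 b * ⟦ R ≟ Xs ⟧) (≡ᵇ-sym 1 x))
  last : ⟦ R ∷ʳ 1 ≟ x ∷ Xs ⟧ ≡ 𝟙 (y ≡ᵇ 1) * ⟦ R ≟ Ys ⟧
  last = begin
    ⟦ R ∷ʳ 1 ≟ x ∷ Xs ⟧      ≡⟨ cong ⟦ R ∷ʳ 1 ≟_⟧ x∷Xs≡Ys∷ʳy ⟩
    ⟦ R ∷ʳ 1 ≟ Ys ∷ʳ y ⟧     ≡⟨ ⟦∷ʳ≟∷ʳ⟧ R 1 Ys y ⟩
    𝟙 (1 ≡ᵇ y) * ⟦ R ≟ Ys ⟧  ≡⟨ cong (λ b → 𝟙 b * ⟦ R ≟ Ys ⟧) (≡ᵇ-sym 1 y) ⟩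
    𝟙 (y ≡ᵇ 1) * ⟦ R ≟ Ys ⟧  ∎

extendPath : List Composition → List (List Composition)
extendPath []         = []
extendPath (R ∷ rest) = map (λ Q → Q ∷ R ∷ rest) (covers R)

stdPaths-suc : ∀ n → stdPaths (suc n) ≡ concatMap extendPath (stdPaths n)
stdPaths-suc n = LP.concatMap-cong (λ { [] → refl ; (R ∷ rest) → refl }) (stdPaths n)

stdPaths-All : ∀ {p} (Pr : Pred (List Composition) p) → Pr ([] ∷ []) →
  (∀ {γ} → Pr γ → All Pr (extendPath γ)) → ∀ n → All Pr (stdPaths n)
stdPaths-All Pr Pr-start Pr-extend zero    = Pr-start ∷ []
stdPaths-All Pr Pr-start Pr-extend (suc n) rewrite stdPaths-suc n =
  AP.concat⁺ (AP.map⁺ (All.map Pr-extend (stdPaths-All Pr Pr-start Pr-extend n)))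

stdPaths-nonempty : ∀ n → All (_≢ []) (stdPaths n)
stdPaths-nonempty = stdPaths-All (_≢ []) (λ ()) nonempty
  where
  nonempty : ∀ {γ} → γ ≢ [] → All (_≢ []) (extendPath γ)
  nonempty {[]}       _ = []
  nonempty {R ∷ rest} _ = AP.map⁺ (All.universal (λ _ ()) (covers R))

pathsTo : ℕ → Composition → ℕ
pathsTo n P = length (filter (λ γ → finalComp γ ≟C P) (stdPaths n))

∑-extendPath : ∀ P γ → γ ≢ [] → ∑[ γ′ ∈ extendPath γ ] ⟦ finalComp γ′ ≟ P ⟧ ≡ ∑[ Q ∈ covers (finalComp γ) ] ⟦ Q ≟ P ⟧
∑-extendPath P []         γ≢[] = contradiction refl γ≢[]
∑-extendPath P (R ∷ rest) _    =
  cong sumℤ (sym (LP.map-∘ {g = λ γ′ → ⟦ finalComp γ′ ≟ P ⟧} {f = λ Q → Q ∷ R ∷ rest} (covers R)))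

pathsTo-suc-covers : ∀ n P → + pathsTo (suc n) P ≡ ∑[ γ ∈ stdPaths n ] ∑[ Q ∈ covers (finalComp γ) ] ⟦ Q ≟ P ⟧
pathsTo-suc-covers n P = begin
  + pathsTo (suc n) P
    ≡⟨ length-filter finalComp P (stdPaths (suc n)) ⟩
  ∑[ γ ∈ stdPaths (suc n) ] ⟦ finalComp γ ≟ P ⟧
    ≡⟨ cong (λ γs → ∑[ γ ∈ γs ] ⟦ finalComp γ ≟ P ⟧) (stdPaths-suc n) ⟩
  ∑[ γ ∈ concatMap extendPath (stdPaths n) ] ⟦ finalComp γ ≟ P ⟧
    ≡⟨ ∑-concatMap _ extendPath (stdPaths n) ⟩
  ∑[ γ ∈ stdPaths n ] ∑[ γ′ ∈ extendPath γ ] ⟦ finalComp γ′ ≟ P ⟧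
    ≡⟨ ∑-congᴬ (All.map (∑-extendPath P _) (stdPaths-nonempty n)) ⟩
  ∑[ γ ∈ stdPaths n ] ∑[ Q ∈ covers (finalComp γ) ] ⟦ Q ≟ P ⟧ ∎

pathsTo-suc : ∀ n x Xs Ys y → x ∷ Xs ≡ Ys ∷ʳ y →
  (+ pathsTo (suc n) (x ∷ Xs)) + 𝟙 (allOnes (x ∷ Xs)) * (+ pathsTo n Xs)
    ≡ 𝟙 (x ≡ᵇ 1) * (+ pathsTo n Xs) + 𝟙 (y ≡ᵇ 1) * (+ pathsTo n Ys) + ∑[ Q ∈ decrements (x ∷ Xs) ] (+ pathsTo n Q)
pathsTo-suc n x Xs Ys y x∷Xs≡Ys∷ʳy = begin
  (+ pathsTo (suc n) P) + c * (+ pathsTo n Xs)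
    ≡⟨ cong₂ (λ s t → s + c * t) (pathsTo-suc-covers n P) (length-filter finalComp Xs γs) ⟩
  ∑[ γ ∈ γs ] ∑[ Q ∈ covers (finalComp γ) ] ⟦ Q ≟ P ⟧ + c * count Xs
    ≡⟨ trans (cong (_+_ (∑[ γ ∈ γs ] ∑[ Q ∈ covers (finalComp γ) ] ⟦ Q ≟ P ⟧)) (sym (∑-*ˡ c _ γs))) (sym (∑-+ _ _ γs)) ⟩
  ∑[ γ ∈ γs ] (∑[ Q ∈ covers (finalComp γ) ] ⟦ Q ≟ P ⟧ + c * ⟦ finalComp γ ≟ Xs ⟧)
    ≡⟨ ∑-cong γs (λ γ → covers-count (finalComp γ) x Xs Ys y x∷Xs≡Ys∷ʳy) ⟩
  ∑[ γ ∈ γs ] (a * ⟦ finalComp γ ≟ Xs ⟧ + b * ⟦ finalComp γ ≟ Ys ⟧ + ∑[ Q ∈ decrements P ] ⟦ Q ≟ finalComp γ ⟧)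
    ≡⟨ trans (∑-+ _ _ γs) (cong (_+ ∑[ γ ∈ γs ] ∑[ Q ∈ decrements P ] ⟦ Q ≟ finalComp γ ⟧)
                               (trans (∑-+ _ _ γs) (cong₂ _+_ (∑-*ˡ a _ γs) (∑-*ˡ b _ γs)))) ⟩
  a * count Xs + b * count Ys + ∑[ γ ∈ γs ] ∑[ Q ∈ decrements P ] ⟦ Q ≟ finalComp γ ⟧
    ≡⟨ cong (_+_ (a * count Xs + b * count Ys))
            (trans (∑-swap _ γs (decrements P)) (∑-cong (decrements P) (λ Q → ∑-cong γs (λ γ → ⟦≟⟧-sym Q (finalComp γ))))) ⟩
  a * count Xs + b * count Ys + ∑[ Q ∈ decrements P ] count Q
    ≡⟨ cong₂ _+_ (cong₂ _+_ (cong (a *_) (length-filter finalComp Xs γs)) (cong (b *_) (length-filter finalComp Ys γs)))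
                 (∑-cong (decrements P) (λ Q → length-filter finalComp Q γs)) ⟨
  a * (+ pathsTo n Xs) + b * (+ pathsTo n Ys) + ∑[ Q ∈ decrements P ] (+ pathsTo n Q) ∎
  where
  P  = x ∷ Xs
  γs = stdPaths n
  a  = 𝟙 (x ≡ᵇ 1)
  b  = 𝟙 (y ≡ᵇ 1)
  c  = 𝟙 (allOnes P)
  count : Composition → ℤ
  count Q = ∑[ γ ∈ γs ] ⟦ finalComp γ ≟ Q ⟧

decrements-weight : ∀ P → All (λ Q → suc (weight Q) ≡ weight P) (decrements P)
decrements-weight []          = []
decrements-weight (zero ∷ P)  = AP.map⁺ (decrements-weight P)
decrements-weight (suc p ∷ P) =
  refl ∷ AP.map⁺ (All.map (λ {Q} w → trans (sym (ℕP.+-suc (suc p) (weight Q))) (cong (suc p ℕ.+_) w)) (decrements-weight P))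

decrements-weight-0 : ∀ P → weight P ≡ 0 → decrements P ≡ []
decrements-weight-0 []         _ = refl
decrements-weight-0 (zero ∷ P) w = cong (map (zero ∷_)) (decrements-weight-0 P w)

weight-∷ʳ : ∀ Ys y → weight (Ys ∷ʳ y) ≡ weight Ys ℕ.+ y
weight-∷ʳ Ys y = trans (sum-++ Ys [ y ]) (cong (weight Ys ℕ.+_) (ℕP.+-identityʳ y))

numPaths-pathsTo : ∀ {n} P → weight P ≡ n → numPaths P ≡ pathsTo n P
numPaths-pathsTo P refl = refl

𝟙-*-pathsTo : ∀ b {n} Q → (T b → weight Q ≡ n) → 𝟙 b * (+ pathsTo n Q) ≡ 𝟙 b * (+ numPaths Q)
𝟙-*-pathsTo false Q _ = refl
𝟙-*-pathsTo true  Q w = cong (λ m → 1ℤ * (+ pathsTo m Q)) (sym (w _))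

numPaths-recurrence : ∀ x Xs Ys y → x ∷ Xs ≡ Ys ∷ʳ y →
  (+ numPaths (x ∷ Xs)) + 𝟙 (allOnes (x ∷ Xs)) * (+ numPaths Xs)
    ≡ 𝟙 (x ≡ᵇ 1) * (+ numPaths Xs) + 𝟙 (y ≡ᵇ 1) * (+ numPaths Ys) + ∑[ Q ∈ decrements (x ∷ Xs) ] (+ numPaths Q)
numPaths-recurrence x Xs Ys y x∷Xs≡Ys∷ʳy with weight (x ∷ Xs) in w
... | zero
  with refl ← ℕP.m+n≡0⇒m≡0 x w
     | refl ← ℕP.m+n≡0⇒n≡0 (weight Ys) (trans (sym (weight-∷ʳ Ys y)) (trans (cong weight (sym x∷Xs≡Ys∷ʳy)) w))
  rewrite decrements-weight-0 Xs w = refl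
... | suc n = begin
  (+ pathsTo (suc n) (x ∷ Xs)) + 𝟙 (allOnes (x ∷ Xs)) * (+ numPaths Xs)
    ≡⟨ cong (_+_ (+ pathsTo (suc n) (x ∷ Xs))) (𝟙-*-pathsTo (allOnes (x ∷ Xs)) Xs (head-one ∘ proj₁ ∘ Equivalence.to T-∧)) ⟨
  (+ pathsTo (suc n) (x ∷ Xs)) + 𝟙 (allOnes (x ∷ Xs)) * (+ pathsTo n Xs)
    ≡⟨ pathsTo-suc n x Xs Ys y x∷Xs≡Ys∷ʳy ⟩
  𝟙 (x ≡ᵇ 1) * (+ pathsTo n Xs) + 𝟙 (y ≡ᵇ 1) * (+ pathsTo n Ys) + ∑[ Q ∈ decrements (x ∷ Xs) ] (+ pathsTo n Q)
    ≡⟨ cong₂ _+_ (cong₂ _+_ (𝟙-*-pathsTo (x ≡ᵇ 1) Xs head-one) (𝟙-*-pathsTo (y ≡ᵇ 1) Ys last-one))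
                 (∑-congᴬ (All.map (λ {Q} w′ → cong +_ (sym (numPaths-pathsTo Q (ℕP.suc-injective (trans w′ w)))))
                                   (decrements-weight (x ∷ Xs)))) ⟩
  𝟙 (x ≡ᵇ 1) * (+ numPaths Xs) + 𝟙 (y ≡ᵇ 1) * (+ numPaths Ys) + ∑[ Q ∈ decrements (x ∷ Xs) ] (+ numPaths Q) ∎
  where
  head-one : T (x ≡ᵇ 1) → weight Xs ≡ n
  head-one x≡ᵇ1 with refl ← ℕP.≡ᵇ⇒≡ x 1 x≡ᵇ1 = ℕP.suc-injective w
  last-one : T (y ≡ᵇ 1) → weight Ys ≡ n
  last-one y≡ᵇ1 with refl ← ℕP.≡ᵇ⇒≡ y 1 y≡ᵇ1 =
    ℕP.suc-injective (trans (trans (ℕP.+-comm 1 (weight Ys)) (sym (weight-∷ʳ Ys 1))) (trans (cong weight (sym x∷Xs≡Ys∷ʳy)) w))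

allPositive : Composition → Bool
allPositive = allᵇ (1 ≤ᵇ_)

allPositive-∷ʳ1 : ∀ R → T (allPositive R) → T (allPositive (R ∷ʳ 1))
allPositive-∷ʳ1 []      _        = _
allPositive-∷ʳ1 (r ∷ R) r∷R-pos with r-pos , R-pos ← Equivalence.to T-∧ r∷R-pos =
  Equivalence.from T-∧ (r-pos , allPositive-∷ʳ1 R R-pos)

allPositive-increments : ∀ R → T (allPositive R) → All (T ∘ allPositive) (increments R)
allPositive-increments []      _        = []
allPositive-increments (r ∷ R) r∷R-pos with r-pos , R-pos ← Equivalence.to T-∧ r∷R-pos =
  R-pos ∷ AP.map⁺ (All.map (λ Q-pos → Equivalence.from T-∧ (r-pos , Q-pos)) (allPositive-increments R R-pos))

stdPaths-positive : ∀ n → All (T ∘ allPositive ∘ finalComp) (stdPaths n)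
stdPaths-positive = stdPaths-All (T ∘ allPositive ∘ finalComp) _ (λ {γ} → positive {γ})
  where
  positive : ∀ {γ} → T (allPositive (finalComp γ)) → All (T ∘ allPositive ∘ finalComp) (extendPath γ)
  positive {[]}       _     = []
  positive {R ∷ rest} R-pos =
    AP.map⁺ (AP.deduplicate⁺ _≟C_ {xs = coversRaw R} (R-pos ∷ allPositive-∷ʳ1 R R-pos ∷ allPositive-increments R R-pos))

numPaths-nonpositive : ∀ P → ¬ T (allPositive P) → numPaths P ≡ 0
numPaths-nonpositive P P-nonpos = cong length (LP.filter-none (λ γ → finalComp γ ≟C P)
  (All.map (λ {γ} γ-pos final≡P → P-nonpos (subst (T ∘ allPositive) final≡P γ-pos)) (stdPaths-positive (weight P))))

-- The window series

allZero : List ℕ → Bool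
allZero = allᵇ (_≡ᵇ 0)

atOffset : ℕ → (List ℕ → ℤ) → List ℕ → ℤ
atOffset zero    G l       = G l
atOffset (suc a) G []      = 0ℤ
atOffset (suc a) G (x ∷ l) = if x ≡ᵇ 0 then atOffset a G l else 0ℤ

pathsCoeff : ℕ → List ℕ → ℤ
pathsCoeff len l = if allZero (L.drop len l) then + numPaths (L.take len l) else 0ℤ

onesCoeff : ℕ → List ℕ → ℤ
onesCoeff len l =
  if allZero (L.drop len l) then 𝟙 (allOnes (L.take len l)) * (+ numPaths (L.drop 1 (L.take len l))) else 0ℤ

-- Past the end of the list nothing is decremented, matching unitᵛ k m = 0 for m ≥ k.
positiveAt : ℕ → List ℕ → Bool
positiveAt m       []      = true
positiveAt zero    (x ∷ l) = 1 ≤ᵇ x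
positiveAt (suc m) (x ∷ l) = positiveAt m l

decrementAt : ℕ → List ℕ → List ℕ
decrementAt m       []      = []
decrementAt zero    (x ∷ l) = x ∸ 1 ∷ l
decrementAt (suc m) (x ∷ l) = x ∷ decrementAt m l

shift : ℕ → (List ℕ → ℤ) → List ℕ → ℤ
shift m G l = if positiveAt m l then G (decrementAt m l) else 0ℤ

interval : ℕ → ℕ → List ℕ
interval a zero      = []
interval a (suc len) = a ∷ interval (suc a) len

interval-suc : ∀ a len → interval (suc a) len ≡ map suc (interval a len)
interval-suc a zero      = refl
interval-suc a (suc len) = cong (suc a ∷_) (interval-suc (suc a) len)

∑-interval-suc : ∀ a len (φ : ℕ → ℤ) → ∑[ m ∈ interval (suc a) len ] φ m ≡ ∑[ m ∈ interval a len ] φ (suc m)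
∑-interval-suc a len φ = trans (cong (λ ms → ∑ ms φ) (interval-suc a len)) (cong sumℤ (sym (LP.map-∘ (interval a len))))

take-length-++ : ∀ (Q Z : List ℕ) → L.take (length Q) (Q ++ Z) ≡ Q
take-length-++ []      Z = refl
take-length-++ (q ∷ Q) Z = cong (q ∷_) (take-length-++ Q Z)

drop-length-++ : ∀ (Q Z : List ℕ) → L.drop (length Q) (Q ++ Z) ≡ Z
drop-length-++ []      Z = refl
drop-length-++ (q ∷ Q) Z = drop-length-++ Q Z

pathsCoeff-++ : ∀ Q Z → pathsCoeff (length Q) (Q ++ Z) ≡ (if allZero Z then + numPaths Q else 0ℤ)
pathsCoeff-++ Q Z rewrite take-length-++ Q Z | drop-length-++ Q Z = refl

decrements-length : ∀ P → All (λ Q → length Q ≡ length P) (decrements P)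
decrements-length []          = []
decrements-length (zero ∷ P)  = AP.map⁺ (All.map (cong suc) (decrements-length P))
decrements-length (suc p ∷ P) = refl ∷ AP.map⁺ (All.map (cong suc) (decrements-length P))

∑-shift : ∀ P Z (G : List ℕ → ℤ) → ∑[ m ∈ interval 0 (length P) ] shift m G (P ++ Z) ≡ ∑[ Q ∈ decrements P ] G (Q ++ Z)
∑-shift []      Z G = refl
∑-shift (p ∷ P) Z G = begin
  shift 0 G ((p ∷ P) ++ Z) + ∑[ m ∈ interval 1 (length P) ] shift m G ((p ∷ P) ++ Z)
    ≡⟨ cong (_+_ (shift 0 G ((p ∷ P) ++ Z))) (trans (∑-interval-suc 0 (length P) _) (∑-shift P Z (G ∘ (p ∷_)))) ⟩
  shift 0 G ((p ∷ P) ++ Z) + ∑[ Q ∈ decrements P ] G (p ∷ Q ++ Z)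
    ≡⟨ head-term p ⟩
  ∑[ Q ∈ decrements (p ∷ P) ] G (Q ++ Z) ∎
  where
  head-term : ∀ p → shift 0 G ((p ∷ P) ++ Z) + ∑[ Q ∈ decrements P ] G (p ∷ Q ++ Z) ≡ ∑[ Q ∈ decrements (p ∷ P) ] G (Q ++ Z)
  head-term zero    = trans (ℤP.+-identityˡ _) (cong sumℤ (LP.map-∘ (decrements P)))
  head-term (suc p) = cong (_+_ (G (p ∷ P ++ Z))) (cong sumℤ (LP.map-∘ (decrements P)))

shift-head : ∀ G x l → shift 0 (atOffset 1 G) (x ∷ l) ≡ 𝟙 (x ≡ᵇ 1) * G l
shift-head G zero          l = refl
shift-head G (suc zero)    l = sym (ℤP.*-identityˡ (G l))
shift-head G (suc (suc x)) l = refl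

shift-last : ∀ G Ys y Z → shift (length Ys) G ((Ys ∷ʳ y) ++ Z) ≡ (if 1 ≤ᵇ y then G (Ys ++ y ∸ 1 ∷ Z) else 0ℤ)
shift-last G Ys y Z rewrite LP.++-assoc Ys [ y ] Z =
  cong₂ (if_then_else 0ℤ) (positiveAt-middle Ys) (cong G (decrementAt-middle Ys))
  where
  positiveAt-middle : ∀ Ys → positiveAt (length Ys) (Ys ++ y ∷ Z) ≡ (1 ≤ᵇ y)
  positiveAt-middle []       = refl
  positiveAt-middle (_ ∷ Ys) = positiveAt-middle Ys
  decrementAt-middle : ∀ Ys → decrementAt (length Ys) (Ys ++ y ∷ Z) ≡ Ys ++ y ∸ 1 ∷ Z
  decrementAt-middle []       = refl
  decrementAt-middle (u ∷ Ys) = cong (u ∷_) (decrementAt-middle Ys)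

snoc-view : ∀ (x : ℕ) Xs → Σ (List ℕ) λ Ys → Σ ℕ λ y → x ∷ Xs ≡ Ys ∷ʳ y
snoc-view x Xs with L.initLast Xs
... | []        = [] , x , refl
... | Ys ∷ʳ′ y  = x ∷ Ys , y , refl

shift-last-pathsCoeff : ∀ Ys y Z →
  shift (length Ys) (pathsCoeff (length Ys)) ((Ys ∷ʳ y) ++ Z) ≡ 𝟙 (y ≡ᵇ 1) * (if allZero Z then + numPaths Ys else 0ℤ)
shift-last-pathsCoeff Ys y Z = begin
  shift (length Ys) (pathsCoeff (length Ys)) ((Ys ∷ʳ y) ++ Z)
    ≡⟨ shift-last (pathsCoeff (length Ys)) Ys y Z ⟩
  (if 1 ≤ᵇ y then pathsCoeff (length Ys) (Ys ++ y ∸ 1 ∷ Z) else 0ℤ)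
    ≡⟨ cong (λ t → if 1 ≤ᵇ y then t else 0ℤ) (pathsCoeff-++ Ys (y ∸ 1 ∷ Z)) ⟩
  (if 1 ≤ᵇ y then (if allZero (y ∸ 1 ∷ Z) then + numPaths Ys else 0ℤ) else 0ℤ)
    ≡⟨ by-last y ⟩
  𝟙 (y ≡ᵇ 1) * (if allZero Z then + numPaths Ys else 0ℤ) ∎
  where
  by-last : ∀ y → (if 1 ≤ᵇ y then (if allZero (y ∸ 1 ∷ Z) then + numPaths Ys else 0ℤ) else 0ℤ)
                  ≡ 𝟙 (y ≡ᵇ 1) * (if allZero Z then + numPaths Ys else 0ℤ)
  by-last zero          = refl
  by-last (suc zero)    = sym (ℤP.*-identityˡ _)
  by-last (suc (suc _)) = refl

∑-shift-pathsCoeff : ∀ P Z → ∑[ m ∈ interval 0 (length P) ] shift m (pathsCoeff (length P)) (P ++ Z)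
                              ≡ ∑[ Q ∈ decrements P ] (if allZero Z then + numPaths Q else 0ℤ)
∑-shift-pathsCoeff P Z = trans (∑-shift P Z (pathsCoeff (length P)))
  (∑-congᴬ (All.map (λ {Q} |Q|≡|P| → subst (λ m → pathsCoeff m (Q ++ Z) ≡ _) |Q|≡|P| (pathsCoeff-++ Q Z))
                    (decrements-length P)))

numPaths-recurrence-if : ∀ x Xs Ys y → x ∷ Xs ≡ Ys ∷ʳ y → ∀ b → let when z = if b then z else 0ℤ in
  when (+ numPaths (x ∷ Xs)) + when (𝟙 (allOnes (x ∷ Xs)) * (+ numPaths Xs))
    ≡ 𝟙 (x ≡ᵇ 1) * when (+ numPaths Xs) + 𝟙 (y ≡ᵇ 1) * when (+ numPaths Ys) + ∑[ Q ∈ decrements (x ∷ Xs) ] when (+ numPaths Q)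
numPaths-recurrence-if x Xs Ys y x∷Xs≡Ys∷ʳy true  = numPaths-recurrence x Xs Ys y x∷Xs≡Ys∷ʳy
numPaths-recurrence-if x Xs Ys y _          false =
  sym (cong₂ _+_ (cong₂ _+_ (ℤP.*-zeroʳ (𝟙 (x ≡ᵇ 1))) (ℤP.*-zeroʳ (𝟙 (y ≡ᵇ 1)))) (∑-zero (decrements (x ∷ Xs))))

window-identity-base : ∀ x Xs Z → let n = length Xs; l = (x ∷ Xs) ++ Z in
  pathsCoeff (suc n) l + onesCoeff (suc n) l
    ≡ shift 0 (atOffset 1 (pathsCoeff n)) l + shift n (pathsCoeff n) l + ∑[ m ∈ interval 0 (suc n) ] shift m (pathsCoeff (suc n)) l
window-identity-base x Xs Z with Ys , y , x∷Xs≡Ys∷ʳy ← snoc-view x Xs = begin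
  pathsCoeff (suc n) l + onesCoeff (suc n) l
    ≡⟨ cong₂ _+_ (pathsCoeff-++ P Z) ones-term ⟩
  when (+ numPaths P) + when (𝟙 (allOnes P) * (+ numPaths Xs))
    ≡⟨ numPaths-recurrence-if x Xs Ys y x∷Xs≡Ys∷ʳy (allZero Z) ⟩
  𝟙 (x ≡ᵇ 1) * when (+ numPaths Xs) + 𝟙 (y ≡ᵇ 1) * when (+ numPaths Ys) + ∑[ Q ∈ decrements P ] when (+ numPaths Q)
    ≡⟨ cong₂ _+_ (cong₂ _+_ head-term last-term) (∑-shift-pathsCoeff P Z) ⟨
  shift 0 (atOffset 1 (pathsCoeff n)) l + shift n (pathsCoeff n) l + ∑[ m ∈ interval 0 (suc n) ] shift m (pathsCoeff (suc n)) l ∎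
  where
  P = x ∷ Xs
  n = length Xs
  l = P ++ Z
  when : ℤ → ℤ
  when z = if allZero Z then z else 0ℤ
  ones-term : onesCoeff (length P) (P ++ Z) ≡ when (𝟙 (allOnes P) * (+ numPaths Xs))
  ones-term rewrite take-length-++ Xs Z | drop-length-++ Xs Z = refl
  head-term : shift 0 (atOffset 1 (pathsCoeff n)) l ≡ 𝟙 (x ≡ᵇ 1) * when (+ numPaths Xs)
  head-term = trans (shift-head (pathsCoeff n) x (Xs ++ Z)) (cong (𝟙 (x ≡ᵇ 1) *_) (pathsCoeff-++ Xs Z))
  |Ys|≡n : length Ys ≡ n
  |Ys|≡n = ℕP.suc-injective (trans (sym (LP.length-++-comm Ys [ y ])) (cong length (sym x∷Xs≡Ys∷ʳy)))
  last-term : shift n (pathsCoeff n) l ≡ 𝟙 (y ≡ᵇ 1) * when (+ numPaths Ys)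
  last-term = subst (λ m → shift m (pathsCoeff m) l ≡ 𝟙 (y ≡ᵇ 1) * when (+ numPaths Ys)) |Ys|≡n
    (subst (λ P′ → shift (length Ys) (pathsCoeff (length Ys)) (P′ ++ Z) ≡ 𝟙 (y ≡ᵇ 1) * when (+ numPaths Ys))
           (sym x∷Xs≡Ys∷ʳy) (shift-last-pathsCoeff Ys y Z))

windowCoeff : ℕ → ℕ → List ℕ → ℤ
windowCoeff a len = atOffset a (pathsCoeff len)

windowOnesCoeff : ℕ → ℕ → List ℕ → ℤ
windowOnesCoeff a len = atOffset a (onesCoeff len)

nonempty-prefix : ∀ n (l : List ℕ) → suc n ≤ length l →
  Σ ℕ λ x → Σ (List ℕ) λ Xs → Σ (List ℕ) λ Z → l ≡ (x ∷ Xs) ++ Z × length Xs ≡ n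
nonempty-prefix zero    (x ∷ l) _       = x , [] , l , refl , refl
nonempty-prefix (suc n) (x ∷ l) (s≤s h) with x′ , Xs , Z , refl , refl ← nonempty-prefix n l h =
  x , x′ ∷ Xs , Z , refl , refl

shift-outside-window : ∀ m a G x l → shift (suc m) (atOffset (suc a) G) (suc x ∷ l) ≡ 0ℤ
shift-outside-window m a G x l with positiveAt m l
... | true  = refl
... | false = refl

window-identity : ∀ a n l → a ℕ.+ suc n ≤ length l →
  windowCoeff a (suc n) l + windowOnesCoeff a (suc n) l
    ≡ shift a (windowCoeff (suc a) n) l + shift (a ℕ.+ n) (windowCoeff a n) l + ∑[ m ∈ interval a (suc n) ] shift m (windowCoeff a (suc n)) l
window-identity zero n l h with x , Xs , Z , refl , refl ← nonempty-prefix n l h = window-identity-base x Xs Z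
window-identity (suc a) n (zero ∷ l) (s≤s h) = trans (window-identity a n l h)
  (cong (_+_ (shift a (windowCoeff (suc a) n) l + shift (a ℕ.+ n) (windowCoeff a n) l))
        (sym (∑-interval-suc a (suc n) (λ m → shift m (windowCoeff (suc a) (suc n)) (zero ∷ l)))))
window-identity (suc a) n (suc x ∷ l) _ = sym (begin
  shift (suc a) (windowCoeff (suc (suc a)) n) (suc x ∷ l) + shift (suc a ℕ.+ n) (windowCoeff (suc a) n) (suc x ∷ l)
    + ∑[ m ∈ interval (suc a) (suc n) ] shift m (windowCoeff (suc a) (suc n)) (suc x ∷ l)
    ≡⟨ cong (_+ ∑[ m ∈ interval (suc a) (suc n) ] shift m (windowCoeff (suc a) (suc n)) (suc x ∷ l))
            (cong₂ _+_ (shift-outside-window a (suc a) (pathsCoeff n) x l) (shift-outside-window (a ℕ.+ n) a (pathsCoeff n) x l)) ⟩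
  0ℤ + ∑[ m ∈ interval (suc a) (suc n) ] shift m (windowCoeff (suc a) (suc n)) (suc x ∷ l)
    ≡⟨ trans (ℤP.+-identityˡ _) (∑-interval-suc a (suc n) (λ m → shift m (windowCoeff (suc a) (suc n)) (suc x ∷ l))) ⟩
  ∑[ m ∈ interval a (suc n) ] shift (suc m) (windowCoeff (suc a) (suc n)) (suc x ∷ l)
    ≡⟨ trans (∑-cong (interval a (suc n)) (λ m → shift-outside-window m a (pathsCoeff (suc n)) x l)) (∑-zero (interval a (suc n))) ⟩
  0ℤ ∎)

-- Monomials and linear factors

unitᵛ : ∀ k → ℕ → Exp k
unitᵛ zero    m       = []
unitᵛ (suc k) zero    = 1 ∷ zeroᵛ k
unitᵛ (suc k) (suc m) = 0 ∷ unitᵛ k m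

_≟ᵛ_ : ∀ {k} → DecidableEquality (Exp k)
_≟ᵛ_ = VP.≡-dec ℕ._≟_

X : ∀ k → ℕ → Series k
X k m e = 𝟙 (does (e ≟ᵛ unitᵛ k m))

X-supported : ∀ k m a → a ≢ unitᵛ k m → X k m a ≡ 0ℤ
X-supported k m a a≢unit = cong 𝟙 (dec-false (a ≟ᵛ unitᵛ k m) a≢unit)

X-unit : ∀ k m → X k m (unitᵛ k m) ≡ 1ℤ
X-unit k m = cong 𝟙 (dec-true (unitᵛ k m ≟ᵛ unitᵛ k m) refl)

unitᵛ-≼ᵇ : ∀ k m (e : Exp k) → (unitᵛ k m ≼ᵇ e) ≡ positiveAt m (V.toList e)
unitᵛ-≼ᵇ zero    m       []      = refl
unitᵛ-≼ᵇ (suc k) zero    (x ∷ e) = trans (cong ((1 ≤ᵇ x) ∧_) (zeroᵛ-≼ᵇ e)) (∧-identityʳ (1 ≤ᵇ x))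
unitᵛ-≼ᵇ (suc k) (suc m) (x ∷ e) = unitᵛ-≼ᵇ k m e

∸ᵛ-unitᵛ : ∀ k m (e : Exp k) → V.toList (e ∸ᵛ unitᵛ k m) ≡ decrementAt m (V.toList e)
∸ᵛ-unitᵛ zero    m       []      = refl
∸ᵛ-unitᵛ (suc k) zero    (x ∷ e) = cong (λ v → x ∸ 1 ∷ V.toList v) (∸ᵛ-identityʳ e)
∸ᵛ-unitᵛ (suc k) (suc m) (x ∷ e) = cong (x ∷_) (∸ᵛ-unitᵛ k m e)

coeffSeries : ∀ k → (List ℕ → ℤ) → Series k
coeffSeries k G e = G (V.toList e)

X-⋆ : ∀ k m G e → (X k m ⋆ coeffSeries k G) e ≡ shift m G (V.toList e)
X-⋆ k m G e = begin
  (X k m ⋆ coeffSeries k G) e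
    ≡⟨ ⋆-monomial (X k m) (coeffSeries k G) (unitᵛ k m) (X-supported k m) e ⟩
  (if unitᵛ k m ≼ᵇ e then X k m (unitᵛ k m) * G (V.toList (e ∸ᵛ unitᵛ k m)) else 0ℤ)
    ≡⟨ cong₂ (if_then_else 0ℤ) (unitᵛ-≼ᵇ k m e)
         (trans (cong (_* G (V.toList (e ∸ᵛ unitᵛ k m))) (X-unit k m))
                (ℤP.*-identityˡ _)) ⟩
  (if positiveAt m (V.toList e) then G (V.toList (e ∸ᵛ unitᵛ k m)) else 0ℤ)
    ≡⟨ cong (λ l → if positiveAt m (V.toList e) then G l else 0ℤ) (∸ᵛ-unitᵛ k m e) ⟩
  shift m G (V.toList e) ∎

linear : ∀ k → ℕ → ℕ → Series k
linear k a len e = oneS e - ∑[ m ∈ interval a len ] X k m e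

⋆-linear : ∀ k a len (F : Series k) e → (F ⋆ linear k a len) e ≡ F e - ∑[ m ∈ interval a len ] (X k m ⋆ F) e
⋆-linear k a len F e = begin
  ∑[ c ≼ e ] (F c * (oneS (e ∸ᵛ c) - ∑[ m ∈ ms ] X k m (e ∸ᵛ c)))
    ≡⟨ ∑-cong (below e) (λ c → trans (ℤP.*-distribˡ-+ (F c) _ _) (cong (_+_ (F c * oneS (e ∸ᵛ c)))
         (trans (sym (ℤP.neg-distribʳ-* (F c) _)) (cong -_ (sym (∑-*ˡ (F c) _ ms)))))) ⟩
  ∑[ c ≼ e ] (F c * oneS (e ∸ᵛ c) + - ∑[ m ∈ ms ] (F c * X k m (e ∸ᵛ c)))
    ≡⟨ ∑-+ _ _ (below e) ⟩
  (F ⋆ oneS) e + ∑[ c ≼ e ] (- ∑[ m ∈ ms ] (F c * X k m (e ∸ᵛ c)))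
    ≡⟨ cong₂ _+_ (⋆-identityʳ F e) (∑-neg _ (below e)) ⟩
  F e - ∑[ c ≼ e ] ∑[ m ∈ ms ] (F c * X k m (e ∸ᵛ c))
    ≡⟨ cong (λ t → F e - t) (∑-swap _ (below e) ms) ⟩
  F e - ∑[ m ∈ ms ] (F ⋆ X k m) e
    ≡⟨ cong (λ t → F e - t) (∑-cong ms (λ m → ⋆-comm F (X k m) e)) ⟩
  F e - ∑[ m ∈ ms ] (X k m ⋆ F) e ∎
  where
  ms = interval a len

-- window k a ℓ is F_{a,ℓ}, and windowOnes k a (ℓ + 1) is N(1^ℓ) x_{a+1}⋯x_{a+ℓ+1}; the code numbers variables from 0.
window : ∀ k → ℕ → ℕ → Series k
window k a len = coeffSeries k (windowCoeff a len)

windowOnes : ∀ k → ℕ → ℕ → Series k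
windowOnes k a len = coeffSeries k (windowOnesCoeff a len)

window-⋆-linear : ∀ k a n → a ℕ.+ suc n ≤ k →
  window k a (suc n) ⋆ linear k a (suc n) ≗ X k a ⋆ window k (suc a) n ⊕ X k (a ℕ.+ n) ⋆ window k a n ⊕ ⊖ windowOnes k a (suc n)
window-⋆-linear k a n a+1+n≤k e = begin
  (window k a (suc n) ⋆ linear k a (suc n)) e
    ≡⟨ ⋆-linear k a (suc n) (window k a (suc n)) e ⟩
  W - ∑[ m ∈ interval a (suc n) ] (X k m ⋆ window k a (suc n)) e
    ≡⟨ cong (_-_ W) (∑-cong (interval a (suc n)) (λ m → X-⋆ k m (windowCoeff a (suc n)) e)) ⟩
  W - S
    ≡⟨ move-terms W O A B S (window-identity a n l (subst (a ℕ.+ suc n ≤_) (sym (VP.length-toList e)) a+1+n≤k)) ⟩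
  A + B - O
    ≡⟨ cong₂ (λ s t → s + t - O) (X-⋆ k a (windowCoeff (suc a) n) e) (X-⋆ k (a ℕ.+ n) (windowCoeff a n) e) ⟨
  (X k a ⋆ window k (suc a) n ⊕ X k (a ℕ.+ n) ⋆ window k a n ⊕ ⊖ windowOnes k a (suc n)) e ∎
  where
  l = V.toList e
  W = windowCoeff a (suc n) l
  O = windowOnesCoeff a (suc n) l
  A = shift a (windowCoeff (suc a) n) l
  B = shift (a ℕ.+ n) (windowCoeff a n) l
  S = ∑[ m ∈ interval a (suc n) ] shift m (windowCoeff a (suc n)) l
  move-terms : ∀ w o s t u → w + o ≡ s + t + u → w - u ≡ s + t - o
  move-terms w o s t u eq = begin
    w - u              ≡⟨ solve 3 (λ w o u → w :- u := w :+ o :- u :- o) refl w o u ⟩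
    w + o - u - o      ≡⟨ cong (λ z → z - u - o) eq ⟩
    s + t + u - u - o  ≡⟨ solve 4 (λ s t u o → s :+ t :+ u :- u :- o := s :+ t :- o) refl s t u o ⟩
    s + t - o          ∎

firstOneIn : ℕ → ℕ → List ℕ → ℕ → Bool
firstOneIn a b []       m = false
firstOneIn a b (n ∷ ns) m = if n ≡ᵇ 1 then (a ≤ᵇ m) ∧ (m ≤ᵇ b) else firstOneIn a b ns (suc m)

firstOneIn-unique : ∀ a b (g : List ℕ → ℕ → Bool) → (∀ m → g [] m ≡ false) →
  (∀ n ns m → g (n ∷ ns) m ≡ (if n ≡ᵇ 1 then (a ≤ᵇ m) ∧ (m ≤ᵇ b) else g ns (suc m))) → ∀ l m → g l m ≡ firstOneIn a b l m
firstOneIn-unique a b g g-[] g-∷ []       m = g-[] m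
firstOneIn-unique a b g g-[] g-∷ (n ∷ ns) m rewrite g-∷ n ns m | firstOneIn-unique a b g g-[] g-∷ ns (suc m) = refl

-- The test for the position of the 1 is a function local to linFactor. Generalising the exponent list and its
-- starting index 0 (hence every literal 0 of the goal, renamed z) turns it into a pattern, so unification can
-- pass it to firstOneIn-unique.
linFactor-spec : ∀ k (i j : Fin k) e → linFactor k i j e ≡
  (if allZero (V.toList e) then 1ℤ else if (deg e ≡ᵇ 1) ∧ firstOneIn (toℕ i) (toℕ j) (V.toList e) 0 then -1ℤ else 0ℤ)
linFactor-spec k i j e with firstOneIn-unique (toℕ i) (toℕ j) _ (λ _ → refl) (λ _ _ _ → refl) | V.toList e | 0
... | inRange≗firstOneIn | l | z =
  cong (λ b → if allᵇ (_≡ᵇ z) l then 1ℤ else if (L.foldr ℕ._+_ z l ≡ᵇ 1) ∧ b then ℤ.negsuc z else + z) (inRange≗firstOneIn l z)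

deg-zeroᵛ : ∀ k → deg (zeroᵛ k) ≡ 0
deg-zeroᵛ zero    = refl
deg-zeroᵛ (suc k) = deg-zeroᵛ k

deg-unitᵛ : ∀ k m → m < k → deg (unitᵛ k m) ≡ 1
deg-unitᵛ (suc k) zero    _         = cong suc (deg-zeroᵛ k)
deg-unitᵛ (suc k) (suc m) (s≤s m<k) = deg-unitᵛ k m m<k

deg≡0⇒zeroᵛ : ∀ {k} (e : Exp k) → deg e ≡ 0 → e ≡ zeroᵛ k
deg≡0⇒zeroᵛ []         _     = refl
deg≡0⇒zeroᵛ (zero ∷ e) deg≡0 = cong (0 ∷_) (deg≡0⇒zeroᵛ e deg≡0)

deg≡1⇒unitᵛ : ∀ {k} (e : Exp k) → deg e ≡ 1 → Σ ℕ λ p → p < k × e ≡ unitᵛ k p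
deg≡1⇒unitᵛ (zero ∷ e) deg≡1 with p , p<k , refl ← deg≡1⇒unitᵛ e deg≡1 = suc p , s≤s p<k , refl
deg≡1⇒unitᵛ {suc k} (suc zero ∷ e) deg≡1 = zero , s≤s z≤n , cong (1 ∷_) (deg≡0⇒zeroᵛ e (ℕP.suc-injective deg≡1))

allZero-deg : ∀ l → allZero l ≡ true → sumℕ l ≡ 0
allZero-deg []         _ = refl
allZero-deg (zero ∷ l) h = allZero-deg l h

unitᵛ-injective : ∀ k p m → p < k → m < k → unitᵛ k p ≡ unitᵛ k m → p ≡ m
unitᵛ-injective (suc k) zero    zero    _         _         _  = refl
unitᵛ-injective (suc k) (suc p) (suc m) (s≤s p<k) (s≤s m<k) eq = cong suc (unitᵛ-injective k p m p<k m<k (cong V.tail eq))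

X-unitᵛ : ∀ k p m → p < k → m < k → X k m (unitᵛ k p) ≡ 𝟙 (p ≡ᵇ m)
X-unitᵛ k p m p<k m<k =
  cong 𝟙 (does-⇔ (mk⇔ (unitᵛ-injective k p m p<k m<k) (cong (unitᵛ k))) (unitᵛ k p ≟ᵛ unitᵛ k m) (p ℕ.≟ m))

firstOneIn-unitᵛ : ∀ a b k p c → p < k → firstOneIn a b (V.toList (unitᵛ k p)) c ≡ (a ≤ᵇ c ℕ.+ p) ∧ (c ℕ.+ p ≤ᵇ b)
firstOneIn-unitᵛ a b (suc k) zero    c _         rewrite ℕP.+-identityʳ c = refl
firstOneIn-unitᵛ a b (suc k) (suc p) c (s≤s p<k) rewrite ℕP.+-suc c p = firstOneIn-unitᵛ a b k p (suc c) p<k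

interval-< : ∀ a len → All (_< a ℕ.+ len) (interval a len)
interval-< a zero      = []
interval-< a (suc len) = ℕP.m<m+n a (s≤s z≤n) ∷ All.map (λ {m} → subst (m <_) (sym (ℕP.+-suc a len))) (interval-< (suc a) len)

≤ᵇ-suc : ∀ m n → (suc m ≤ᵇ suc n) ≡ (m ≤ᵇ n)
≤ᵇ-suc zero    n = refl
≤ᵇ-suc (suc m) n = refl

∑-interval-≡ᵇ : ∀ a len p → ∑[ m ∈ interval a len ] 𝟙 (p ≡ᵇ m) ≡ 𝟙 ((a ≤ᵇ p) ∧ (p ℕ.<ᵇ a ℕ.+ len))
∑-interval-≡ᵇ zero    zero      p       = refl
∑-interval-≡ᵇ zero    (suc len) zero    = cong (_+_ 1ℤ) (∑-interval-≡ᵇ 1 len zero)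
∑-interval-≡ᵇ zero    (suc len) (suc p) = trans (ℤP.+-identityˡ _) (trans (∑-interval-suc 0 len _) (∑-interval-≡ᵇ zero len p))
∑-interval-≡ᵇ (suc a) len       zero    = trans (∑-interval-suc a len _) (∑-zero (interval a len))
∑-interval-≡ᵇ (suc a) len       (suc p) = trans (∑-interval-suc a len _)
  (trans (∑-interval-≡ᵇ a len p) (cong (λ b → 𝟙 (b ∧ (p ℕ.<ᵇ a ℕ.+ len))) (sym (≤ᵇ-suc a p))))

allZero-unitᵛ : ∀ k p → p < k → allZero (V.toList (unitᵛ k p)) ≡ false
allZero-unitᵛ (suc k) zero    _         = refl
allZero-unitᵛ (suc k) (suc p) (s≤s p<k) = allZero-unitᵛ k p p<k

∑X-nonunit : ∀ k a len (e : Exp k) → a ℕ.+ len ≤ k → deg e ≢ 1 → ∑[ m ∈ interval a len ] X k m e ≡ 0ℤ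
∑X-nonunit k a len e a+len≤k deg≢1 = trans (∑-congᴬ (All.map X-vanishes (interval-< a len))) (∑-zero (interval a len))
  where
  X-vanishes : ∀ {m} → m < a ℕ.+ len → X k m e ≡ 0ℤ
  X-vanishes {m} m<a+len =
    X-supported k m e (λ e≡unit → deg≢1 (trans (cong deg e≡unit) (deg-unitᵛ k m (ℕP.<-≤-trans m<a+len a+len≤k))))

∑X-unitᵛ : ∀ k a len p → a ℕ.+ len ≤ k → p < k → ∑[ m ∈ interval a len ] X k m (unitᵛ k p) ≡ 𝟙 ((a ≤ᵇ p) ∧ (p ℕ.<ᵇ a ℕ.+ len))
∑X-unitᵛ k a len p a+len≤k p<k =
  trans (∑-congᴬ (All.map (λ m<a+len → X-unitᵛ k p _ p<k (ℕP.<-≤-trans m<a+len a+len≤k)) (interval-< a len)))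
        (∑-interval-≡ᵇ a len p)

interval-end : ∀ {a b} → a ≤ b → a ℕ.+ suc (b ∸ a) ≡ suc b
interval-end {a} {b} a≤b = trans (ℕP.+-suc a (b ∸ a)) (cong suc (ℕP.m+[n∸m]≡n a≤b))

<ᵇ-suc : ∀ m n → (m ℕ.<ᵇ suc n) ≡ (m ≤ᵇ n)
<ᵇ-suc zero    n = refl
<ᵇ-suc (suc m) n = refl

linFactor-linear : ∀ k (i j : Fin k) → toℕ i ≤ toℕ j → linFactor k i j ≗ linear k (toℕ i) (suc (toℕ j ∸ toℕ i))
linFactor-linear k i j i≤j e with deg e ℕ.≟ 1
... | no deg≢1 = begin
  linFactor k i j e
    ≡⟨ linFactor-spec k i j e ⟩
  (if allZero (V.toList e) then 1ℤ else if (deg e ≡ᵇ 1) ∧ firstOneIn a b (V.toList e) 0 then -1ℤ else 0ℤ)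
    ≡⟨ cong (λ c → if allZero (V.toList e) then 1ℤ else if c ∧ firstOneIn a b (V.toList e) 0 then -1ℤ else 0ℤ)
            (dec-false (deg e ℕ.≟ 1) deg≢1) ⟩
  oneS e
    ≡⟨ ℤP.+-identityʳ (oneS e) ⟨
  oneS e - 0ℤ
    ≡⟨ cong (_-_ (oneS e)) (∑X-nonunit k a (suc (b ∸ a)) e a+len≤k deg≢1) ⟨
  linear k a (suc (b ∸ a)) e ∎
  where
  a = toℕ i
  b = toℕ j
  a+len≤k : a ℕ.+ suc (b ∸ a) ≤ k
  a+len≤k = subst (_≤ k) (sym (interval-end i≤j)) (FP.toℕ<n j)
... | yes deg≡1 with p , p<k , refl ← deg≡1⇒unitᵛ e deg≡1 = begin
  linFactor k i j u
    ≡⟨ linFactor-spec k i j u ⟩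
  (if allZero (V.toList u) then 1ℤ else if (deg u ≡ᵇ 1) ∧ firstOneIn a b (V.toList u) 0 then -1ℤ else 0ℤ)
    ≡⟨ cong₂ (λ z c → if z then 1ℤ else if c then -1ℤ else 0ℤ) (allZero-unitᵛ k p p<k)
             (cong₂ _∧_ (cong (_≡ᵇ 1) (deg-unitᵛ k p p<k)) (firstOneIn-unitᵛ a b k p 0 p<k)) ⟩
  (if (a ≤ᵇ p) ∧ (p ≤ᵇ b) then -1ℤ else 0ℤ)
    ≡⟨ cong (λ c → if (a ≤ᵇ p) ∧ c then -1ℤ else 0ℤ) (trans (cong (p ℕ.<ᵇ_) (interval-end i≤j)) (<ᵇ-suc p b)) ⟨
  (if (a ≤ᵇ p) ∧ (p ℕ.<ᵇ a ℕ.+ suc (b ∸ a)) then -1ℤ else 0ℤ)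
    ≡⟨ negated-𝟙 ((a ≤ᵇ p) ∧ (p ℕ.<ᵇ a ℕ.+ suc (b ∸ a))) ⟩
  0ℤ - 𝟙 ((a ≤ᵇ p) ∧ (p ℕ.<ᵇ a ℕ.+ suc (b ∸ a)))
    ≡⟨ cong₂ _-_ (cong (if_then 1ℤ else 0ℤ) (allZero-unitᵛ k p p<k)) (∑X-unitᵛ k a (suc (b ∸ a)) p a+len≤k p<k) ⟨
  linear k a (suc (b ∸ a)) u ∎
  where
  a = toℕ i
  b = toℕ j
  u = unitᵛ k p
  a+len≤k : a ℕ.+ suc (b ∸ a) ≤ k
  a+len≤k = subst (_≤ k) (sym (interval-end i≤j)) (FP.toℕ<n j)
  negated-𝟙 : ∀ c → (if c then -1ℤ else 0ℤ) ≡ 0ℤ - 𝟙 c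
  negated-𝟙 true  = refl
  negated-𝟙 false = refl

-- Polynomiality and the main theorem

isPolynomial-X : ∀ k m → IsPolynomial (X k m)
isPolynomial-X k m = isPolynomial-monomial (X k m) (unitᵛ k m) (X-supported k m)

isPolynomial-linFactor : ∀ k i j → IsPolynomial (linFactor k i j)
isPolynomial-linFactor k i j = 1 , λ e 1<deg → trans (linFactor-spec k i j e) (vanishes e 1<deg)
  where
  vanishes : ∀ e → 1 < deg e →
    (if allZero (V.toList e) then 1ℤ else if (deg e ≡ᵇ 1) ∧ firstOneIn (toℕ i) (toℕ j) (V.toList e) 0 then -1ℤ else 0ℤ) ≡ 0ℤ
  vanishes e 1<deg with allZero (V.toList e) in all-zero
  ... | true  = contradiction (allZero-deg (V.toList e) all-zero) (ℕP.<⇒≢ (ℕP.<-trans (s≤s z≤n) 1<deg) ∘ sym)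
  ... | false rewrite dec-false (deg e ℕ.≟ 1) (ℕP.<⇒≢ 1<deg ∘ sym) = refl

isPolynomial-atOffset : ∀ k N a G → (∀ l → N < sumℕ l → G l ≡ 0ℤ) → IsPolynomial (coeffSeries k (atOffset a G))
isPolynomial-atOffset k N a G G-vanishes = N , λ e N<deg → vanishes a (V.toList e) N<deg
  where
  vanishes : ∀ a l → N < sumℕ l → atOffset a G l ≡ 0ℤ
  vanishes zero    l           N<Σl = G-vanishes l N<Σl
  vanishes (suc a) []          _    = refl
  vanishes (suc a) (zero ∷ l)  N<Σl = vanishes a l N<Σl
  vanishes (suc a) (suc _ ∷ l) _    = refl

isPolynomial-window-0 : ∀ k a → IsPolynomial (window k a 0)
isPolynomial-window-0 k a = isPolynomial-atOffset k 0 a (pathsCoeff 0) vanishes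
  where
  vanishes : ∀ l → 0 < sumℕ l → pathsCoeff 0 l ≡ 0ℤ
  vanishes l 0<Σl with allZero l in all-zero
  ... | true  = contradiction (allZero-deg l all-zero) (ℕP.<⇒≢ 0<Σl ∘ sym)
  ... | false = refl

isPolynomial-windowOnes : ∀ k a len → IsPolynomial (windowOnes k a len)
isPolynomial-windowOnes k a len = isPolynomial-atOffset k len a (onesCoeff len) vanishes
  where
  ones-deg : ∀ len l → allZero (L.drop len l) ≡ true → allOnes (L.take len l) ≡ true → sumℕ l ≤ len
  ones-deg zero      l                 zeros _    = ℕP.≤-reflexive (allZero-deg l zeros)
  ones-deg (suc len) []                _     _    = z≤n
  ones-deg (suc len) (suc zero ∷ l)    zeros ones = s≤s (ones-deg len l zeros ones)
  vanishes : ∀ l → len < sumℕ l → onesCoeff len l ≡ 0ℤ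
  vanishes l len<Σl with allZero (L.drop len l) in zeros | allOnes (L.take len l) in ones
  ... | true  | true  = contradiction (ones-deg len l zeros ones) (ℕP.<⇒≱ len<Σl)
  ... | true  | false = refl
  ... | false | _     = refl

linFactorOf : ∀ k → Fin k × Fin k → Series k
linFactorOf k (i , j) = linFactor k i j

isPolynomial-prodS-linFactors : ∀ k Js → IsPolynomial (prodS (map (linFactorOf k) Js))
isPolynomial-prodS-linFactors k Js = isPolynomial-prodS (AP.map⁺ (All.universal (λ (i , j) → isPolynomial-linFactor k i j) Js))

Covers : ∀ k → ℕ → ℕ → List (Fin k × Fin k) → Set
Covers k a len Js = ∀ (i j : Fin k) → a ≤ toℕ i → toℕ i ≤ toℕ j → toℕ j < a ℕ.+ len → (i , j) ∈ Js

Covers-⊆ : ∀ {k a len a′ len′ Js} → Covers k a len Js → a ≤ a′ → a′ ℕ.+ len′ ≤ a ℕ.+ len → Covers k a′ len′ Js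
Covers-⊆ cover a≤a′ end′≤end i j a′≤i i≤j j<end′ = cover i j (ℕP.≤-trans a≤a′ a′≤i) i≤j (ℕP.<-≤-trans j<end′ end′≤end)

Covers-without : ∀ {k a len} ys zs p → Covers k a len (ys ++ [ p ] ++ zs) →
  (∀ i j → a ≤ toℕ i → toℕ j < a ℕ.+ len → (i , j) ≢ p) → Covers k a len (ys ++ zs)
Covers-without ys zs p cover p-outside i j a≤i i≤j j<end with MP.∈-++⁻ ys (cover i j a≤i i≤j j<end)
... | inj₁ ∈ys         = MP.∈-++⁺ˡ ∈ys
... | inj₂ (here ≡p)   = contradiction ≡p (p-outside i j a≤i j<end)
... | inj₂ (there ∈zs) = MP.∈-++⁺ʳ ys ∈zs

linFactor-full : ∀ k a n (i j : Fin k) → toℕ i ≡ a → toℕ j ≡ a ℕ.+ n → linFactor k i j ≗ linear k a (suc n)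
linFactor-full k _ n i j refl j≡i+n = subst (λ len → linFactor k i j ≗ linear k (toℕ i) (suc len)) length≡n
  (linFactor-linear k i j (subst (toℕ i ≤_) (sym j≡i+n) (ℕP.m≤m+n (toℕ i) n)))
  where
  length≡n : toℕ j ∸ toℕ i ≡ n
  length≡n = trans (cong (_∸ toℕ i) j≡i+n) (ℕP.m+n∸m≡n (toℕ i) n)

window-⋆-peel : ∀ k a n → a ℕ.+ suc n ≤ k → ∀ (i j : Fin k) → toℕ i ≡ a → toℕ j ≡ a ℕ.+ n → ∀ ys zs →
  let R = prodS (map (linFactorOf k) (ys ++ zs)) in
  window k a (suc n) ⋆ prodS (map (linFactorOf k) (ys ++ [ (i , j) ] ++ zs))
    ≗ X k a ⋆ (window k (suc a) n ⋆ R) ⊕ X k (a ℕ.+ n) ⋆ (window k a n ⋆ R) ⊕ ⊖ (windowOnes k a (suc n) ⋆ R)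
window-⋆-peel k a n a+1+n≤k i j i≡a j≡a+n ys zs e = begin
  (W ⋆ prodS (map (linFactorOf k) (ys ++ [ (i , j) ] ++ zs))) e
    ≡⟨ ⋆-congʳ W (prodS-↭ (PermP.map⁺ (linFactorOf k) (PermP.shift (i , j) ys zs))) e ⟩
  (W ⋆ (linFactor k i j ⋆ R)) e
    ≡⟨ ⋆-assoc W (linFactor k i j) R e ⟨
  ((W ⋆ linFactor k i j) ⋆ R) e
    ≡⟨ ⋆-congˡ R (⋆-congʳ W (linFactor-full k a n i j i≡a j≡a+n)) e ⟩
  ((W ⋆ linear k a (suc n)) ⋆ R) e
    ≡⟨ ⋆-congˡ R (window-⋆-linear k a n a+1+n≤k) e ⟩
  ((A ⊕ B ⊕ ⊖ M) ⋆ R) e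
    ≡⟨ ⋆-distribʳ-⊕ R (A ⊕ B) (⊖ M) e ⟩
  ((A ⊕ B) ⋆ R) e + ((⊖ M) ⋆ R) e
    ≡⟨ cong₂ _+_ (⋆-distribʳ-⊕ R A B e) (⋆-⊖ˡ M R e) ⟩
  (A ⋆ R) e + (B ⋆ R) e + - (M ⋆ R) e
    ≡⟨ cong (λ t → t + - (M ⋆ R) e)
            (cong₂ _+_ (⋆-assoc (X k a) (window k (suc a) n) R e) (⋆-assoc (X k (a ℕ.+ n)) (window k a n) R e)) ⟩
  (X k a ⋆ (window k (suc a) n ⋆ R) ⊕ X k (a ℕ.+ n) ⋆ (window k a n ⋆ R) ⊕ ⊖ (M ⋆ R)) e ∎
  where
  W = window k a (suc n)
  R = prodS (map (linFactorOf k) (ys ++ zs))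
  A = X k a ⋆ window k (suc a) n
  B = X k (a ℕ.+ n) ⋆ window k a n
  M = windowOnes k a (suc n)

fullInterval : ∀ {k} a n → a ℕ.+ suc n ≤ k → Σ (Fin k) λ i → Σ (Fin k) λ j → toℕ i ≡ a × toℕ j ≡ a ℕ.+ n
fullInterval a n a+1+n≤k =
  fromℕ< (ℕP.<-≤-trans (ℕP.m<m+n a (s≤s z≤n)) a+1+n≤k) , fromℕ< (ℕP.<-≤-trans (ℕP.+-monoʳ-< a (ℕP.n<1+n n)) a+1+n≤k) ,
  FP.toℕ-fromℕ< _ , FP.toℕ-fromℕ< _

isPolynomial-window-⋆ : ∀ k len a → a ℕ.+ len ≤ k → ∀ Js → Covers k a len Js →
  IsPolynomial (window k a len ⋆ prodS (map (linFactorOf k) Js))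
isPolynomial-window-⋆ k zero    a _         Js _ =
  isPolynomial-⋆ (isPolynomial-window-0 k a) (isPolynomial-prodS-linFactors k Js)
isPolynomial-window-⋆ k (suc n) a a+1+n≤k Js cover
  with i , j , i≡a , j≡a+n ← fullInterval a n a+1+n≤k
  with ys , zs , refl ← MP.∈-∃++ (cover i j (ℕP.≤-reflexive (sym i≡a)) (subst₂ _≤_ (sym i≡a) (sym j≡a+n) (ℕP.m≤m+n a n))
                                          (subst (_< a ℕ.+ suc n) (sym j≡a+n) (ℕP.+-monoʳ-< a (ℕP.n<1+n n)))) =
  isPolynomial-≗ (λ e → sym (window-⋆-peel k a n a+1+n≤k i j i≡a j≡a+n ys zs e))
    (isPolynomial-⊕
      (isPolynomial-⊕
        (isPolynomial-⋆ (isPolynomial-X k a) (isPolynomial-window-⋆ k n (suc a) a+1+n≤k′ (ys ++ zs) cover-tail))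
        (isPolynomial-⋆ (isPolynomial-X k (a ℕ.+ n)) (isPolynomial-window-⋆ k n a a+n≤k (ys ++ zs) cover-init)))
      (isPolynomial-⊖ (isPolynomial-⋆ (isPolynomial-windowOnes k a (suc n)) (isPolynomial-prodS-linFactors k (ys ++ zs)))))
  where
  a+1+n≤k′ : suc a ℕ.+ n ≤ k
  a+1+n≤k′ = subst (_≤ k) (ℕP.+-suc a n) a+1+n≤k
  a+n≤k : a ℕ.+ n ≤ k
  a+n≤k = ℕP.≤-trans (ℕP.+-monoʳ-≤ a (ℕP.n≤1+n n)) a+1+n≤k
  cover-tail : Covers k (suc a) n (ys ++ zs)
  cover-tail = Covers-without ys zs (i , j) (Covers-⊆ cover (ℕP.n≤1+n a) (ℕP.≤-reflexive (sym (ℕP.+-suc a n))))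
    (λ i′ j′ a<i′ _ i′j′≡ij → ℕP.<⇒≢ a<i′ (sym (trans (cong (toℕ ∘ proj₁) i′j′≡ij) i≡a)))
  cover-init : Covers k a n (ys ++ zs)
  cover-init = Covers-without ys zs (i , j) (Covers-⊆ cover ℕP.≤-refl (ℕP.+-monoʳ-≤ a (ℕP.n≤1+n n)))
    (λ i′ j′ _ j′<a+n i′j′≡ij → ℕP.<⇒≢ j′<a+n (trans (cong (toℕ ∘ proj₂) i′j′≡ij) j≡a+n))

f-window : ∀ k → f k ≗ window k 0 k
f-window k e rewrite LP.take-all k (V.toList e) (ℕP.≤-reflexive (VP.length-toList e))
                   | LP.drop-all k (V.toList e) (ℕP.≤-reflexive (VP.length-toList e))
  with allPositive (V.toList e) in positive
... | true  = refl
... | false = cong +_ (sym (numPaths-nonpositive (V.toList e) (subst T positive)))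

intervals : ∀ k → List (Fin k × Fin k)
intervals k = concatMap (λ i → concatMap (λ j → if toℕ i ≤ᵇ toℕ j then [ (i , j) ] else []) (L.allFin k)) (L.allFin k)

denom-intervals : ∀ k → denom k ≡ prodS (map (linFactorOf k) (intervals k))
denom-intervals k = cong prodS (sym (trans (LP.map-concatMap (linFactorOf k) _ (L.allFin k))
  (LP.concatMap-cong (λ i → trans (LP.map-concatMap (linFactorOf k) _ (L.allFin k))
                                  (LP.concatMap-cong (λ j → map-if (toℕ i ≤ᵇ toℕ j) (i , j)) (L.allFin k))) (L.allFin k))))
  where
  map-if : ∀ b p → map (linFactorOf k) (if b then [ p ] else []) ≡ (if b then [ linFactorOf k p ] else [])
  map-if true  p = refl
  map-if false p = refl

intervals-covers : ∀ k → Covers k 0 k (intervals k)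
intervals-covers k i j _ i≤j _ =
  MP.∈-concatMap⁺ rowOf
    (Any.map (λ { refl → MP.∈-concatMap⁺ (entry i) (Any.map (λ { refl → ij∈ }) (MP.∈-allFin j)) }) (MP.∈-allFin i))
  where
  entry : Fin k → Fin k → List (Fin k × Fin k)
  entry i j = if toℕ i ≤ᵇ toℕ j then [ (i , j) ] else []
  rowOf : Fin k → List (Fin k × Fin k)
  rowOf i = concatMap (entry i) (L.allFin k)
  ij∈ : (i , j) ∈ (if toℕ i ≤ᵇ toℕ j then [ (i , j) ] else [])
  ij∈ rewrite ≤ᵇ-true i≤j = here refl

oneᵛ : ∀ k → Exp k
oneᵛ k = V.replicate k 1

xAll-supported : ∀ k (a : Exp k) → a ≢ oneᵛ k → xAll k a ≡ 0ℤ
xAll-supported zero    []                  a≢1 = contradiction refl a≢1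
xAll-supported (suc k) (zero ∷ a)          _   = refl
xAll-supported (suc k) (suc zero ∷ a)      a≢1 = xAll-supported k a (a≢1 ∘ cong (1 ∷_))
xAll-supported (suc k) (suc (suc _) ∷ a)   _   = refl

xAll-oneᵛ : ∀ k → xAll k (oneᵛ k) ≡ 1ℤ
xAll-oneᵛ zero    = refl
xAll-oneᵛ (suc k) = xAll-oneᵛ k

oneᵛ-≼ᵇ : ∀ {k} (e : Exp k) → (oneᵛ k ≼ᵇ e) ≡ allPositive (V.toList e)
oneᵛ-≼ᵇ []      = refl
oneᵛ-≼ᵇ (x ∷ e) = cong ((1 ≤ᵇ x) ∧_) (oneᵛ-≼ᵇ e)

suc-∸ᵛ-oneᵛ : ∀ {k} (e : Exp k) → T (allPositive (V.toList e)) → V.map suc (e ∸ᵛ oneᵛ k) ≡ e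
suc-∸ᵛ-oneᵛ []          _     = refl
suc-∸ᵛ-oneᵛ (suc x ∷ e) e-pos = cong (suc x ∷_) (suc-∸ᵛ-oneᵛ e e-pos)

≼-allPositive : ∀ {k} {a e : Exp k} → a ≼ e → T (allPositive (V.toList a)) → T (allPositive (V.toList e))
≼-allPositive []            _     = _
≼-allPositive (x≤y ∷ a≼e) a-pos with x-pos , rest-pos ← Equivalence.to T-∧ a-pos =
  Equivalence.from T-∧ (ℕP.≤⇒≤ᵇ (ℕP.≤-trans (ℕP.≤ᵇ⇒≤ 1 _ x-pos) x≤y) , ≼-allPositive a≼e rest-pos)

shifted : ∀ {k} → Series k → Series k
shifted P e = P (V.map suc e)

deg-map-suc : ∀ {k} (e : Exp k) → deg e ≤ deg (V.map suc e)
deg-map-suc []      = z≤n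
deg-map-suc (x ∷ e) = ℕP.+-mono-≤ (ℕP.n≤1+n x) (deg-map-suc e)

xAll-⋆-shifted : ∀ k (P : Series k) → (∀ e → ¬ T (allPositive (V.toList e)) → P e ≡ 0ℤ) → P ≗ xAll k ⋆ shifted P
xAll-⋆-shifted k P P-vanishes e = begin
  P e
    ≡⟨ by-positivity (allPositive (V.toList e)) refl ⟨
  (if oneᵛ k ≼ᵇ e then xAll k (oneᵛ k) * shifted P (e ∸ᵛ oneᵛ k) else 0ℤ)
    ≡⟨ ⋆-monomial (xAll k) (shifted P) (oneᵛ k) (xAll-supported k) e ⟨
  (xAll k ⋆ shifted P) e ∎
  where
  by-positivity : ∀ b → allPositive (V.toList e) ≡ b →
    (if oneᵛ k ≼ᵇ e then xAll k (oneᵛ k) * shifted P (e ∸ᵛ oneᵛ k) else 0ℤ) ≡ P e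
  by-positivity true  positive rewrite oneᵛ-≼ᵇ e | positive | xAll-oneᵛ k =
    trans (ℤP.*-identityˡ _) (cong P (suc-∸ᵛ-oneᵛ e (subst T (sym positive) _)))
  by-positivity false positive rewrite oneᵛ-≼ᵇ e | positive = sym (P-vanishes e (subst T positive))

isPolynomial-shifted : ∀ {k} {P : Series k} → IsPolynomial P → IsPolynomial (shifted P)
isPolynomial-shifted (N , P-vanishes) = N , λ e N<deg → P-vanishes (V.map suc e) (ℕP.<-≤-trans N<deg (deg-map-suc e))

⋆-vanishes-off-positive : ∀ {k} (F G : Series k) → (∀ a → ¬ T (allPositive (V.toList a)) → F a ≡ 0ℤ) →
  ∀ e → ¬ T (allPositive (V.toList e)) → (F ⋆ G) e ≡ 0ℤ
⋆-vanishes-off-positive F G F-vanishes e e-nonpositive =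
  ∑≼-vanishes e (λ a a≼e → cong (_* G (e ∸ᵛ a)) (F-vanishes a (e-nonpositive ∘ ≼-allPositive a≼e)))

f-vanishes-off-positive : ∀ k e → ¬ T (allPositive (V.toList e)) → f k e ≡ 0ℤ
f-vanishes-off-positive k e e-nonpositive with allPositive (V.toList e) in positive
... | true  = contradiction _ e-nonpositive
... | false = refl

isPolynomial-f⋆denom : ∀ k → IsPolynomial (f k ⋆ denom k)
isPolynomial-f⋆denom k = isPolynomial-≗ window≗f⋆denom (isPolynomial-window-⋆ k k 0 ℕP.≤-refl (intervals k) (intervals-covers k))
  where
  window≗f⋆denom : window k 0 k ⋆ prodS (map (linFactorOf k) (intervals k)) ≗ f k ⋆ denom k
  window≗f⋆denom e = sym (trans (⋆-congˡ (denom k) (f-window k) e) (cong (λ D → (window k 0 k ⋆ D) e) (denom-intervals k)))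

mainTheorem2 : (k : ℕ) → Σ (Series k) λ g →
    IsPolynomial g × (∀ (e : Exp k) → (f k ⋆ denom k) e ≡ (xAll k ⋆ g) e)
mainTheorem2 k =
  shifted (f k ⋆ denom k) ,
  isPolynomial-shifted (isPolynomial-f⋆denom k) ,
  xAll-⋆-shifted k (f k ⋆ denom k) (⋆-vanishes-off-positive (f k) (denom k) (f-vanishes-off-positive k))
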